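{- Let $p$ and $q$ be distinct primes and $n = p^2 q$. Then the multiset of Laplacian eigenvalues of the cozero-divisor graph $\Gamma'(\mathbb{Z}_n)$ consists of $p^2-p$ with multiplicity $(p-1)(q-1)-1$, $pq-p$ with multiplicity $p^2-p-1$, $p^2-1$ with multiplicity $q-2$, $q-1$ with multiplicity $p-2$, together with the four zeros of the polynomial $$l(x) = x^4 - \{(p-1)(2p+1) + (p+1)(q-1)\}x^3 + \{p(p-1)^2(p+1) + (p-1)(p+1)^2(q-1) + p(q-1)^2 + (p-1)^2(q-1)\}x^2 - p(p-1)(q-1)\{(p-1)(p+1) + p(q-1)\}x.$$
   Context: The cozero-divisor graph $\Gamma'(R)$ of a commutative ring $R$ with unity is the simple undirected graph whose vertices are the non-zero non-unit elements of $R$, with distinct $x,y$ adjacent iff $x \notin Ry$ and $y \notin Rx$. The Laplacian eigenvalues of a graph are the eigenvalues of $D - A$ (degree diagonal matrix minus adjacency matrix). -}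

module Defs where

open import Data.Nat as ℕ using (ℕ; zero; suc; _%_)
open import Data.Integer as ℤ using (ℤ; +_; -_; _-_; _^_)
open import Data.Fin using (Fin; zero; suc; toℕ; punchIn)
open import Data.Fin.Properties using (any?) renaming (_≟_ to _≟ᶠ_)
open import Data.List using (List; filter; length; lookup)
open import Data.List.Base using (allFin)
open import Data.Product using (∃; _×_)
open import Relation.Nullary using (¬_; Dec; yes; no; _×-dec_; ¬?)
open import Relation.Binary.PropositionalEquality using (_≡_; _≢_)
import Data.Nat.Properties as ℕP

-- The ring ℤ_n, with carrier Fin n (residues 0 … n-1).

-- reduction modulo n (n = 0 never occurs for nonempty Fin n)
modN : ℕ → ℕ → ℕ
modN zero    a = a
modN (suc k) a = a % suc k

InIdeal : (n : ℕ) → Fin n → Fin n → Set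
InIdeal n x y = ∃ λ (r : Fin n) → modN n (toℕ r ℕ.* toℕ y) ≡ toℕ x

InIdeal? : (n : ℕ) (x y : Fin n) → Dec (InIdeal n x y)
InIdeal? n x y = any? (λ r → modN n (toℕ r ℕ.* toℕ y) ℕP.≟ toℕ x)

IsUnit : (n : ℕ) → Fin n → Set
IsUnit n x = ∃ λ (r : Fin n) → modN n (toℕ r ℕ.* toℕ x) ≡ modN n 1

IsUnit? : (n : ℕ) (x : Fin n) → Dec (IsUnit n x)
IsUnit? n x = any? (λ r → modN n (toℕ r ℕ.* toℕ x) ℕP.≟ modN n 1)

IsVertex : (n : ℕ) → Fin n → Set
IsVertex n x = (toℕ x ≢ 0) × ¬ IsUnit n x

IsVertex? : (n : ℕ) (x : Fin n) → Dec (IsVertex n x)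
IsVertex? n x = ¬? (toℕ x ℕP.≟ 0) ×-dec ¬? (IsUnit? n x)

vertices : (n : ℕ) → List (Fin n)
vertices n = filter (IsVertex? n) (allFin n)

numVertices : ℕ → ℕ
numVertices n = length (vertices n)

vertex : (n : ℕ) → Fin (numVertices n) → Fin n
vertex n i = lookup (vertices n) i

Adjacent : (n : ℕ) → Fin (numVertices n) → Fin (numVertices n) → Set
Adjacent n i j = (i ≢ j) × (¬ InIdeal n (vertex n i) (vertex n j)) × (¬ InIdeal n (vertex n j) (vertex n i))

Adjacent? : (n : ℕ) (i j : Fin (numVertices n)) → Dec (Adjacent n i j)
Adjacent? n i j = ¬? (i ≟ᶠ j) ×-dec (¬? (InIdeal? n (vertex n i) (vertex n j)) ×-dec ¬? (InIdeal? n (vertex n j) (vertex n i)))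

Matrix : ℕ → Set
Matrix m = Fin m → Fin m → ℤ

sumFin : (m : ℕ) → (Fin m → ℤ) → ℤ
sumFin zero    f = + 0
sumFin (suc m) f = f zero ℤ.+ sumFin m (λ i → f (suc i))

det : (m : ℕ) → Matrix m → ℤ
det zero    M = + 1
det (suc m) M = sumFin (suc m) (λ j →
  ((- + 1) ^ toℕ j) ℤ.* (M zero j ℤ.* det m (λ a b → M (suc a) (punchIn j b))))

adjMatrix : (n : ℕ) → Matrix (numVertices n)
adjMatrix n i j with Adjacent? n i j
... | yes _ = + 1
... | no  _ = + 0

degree : (n : ℕ) → Fin (numVertices n) → ℤ
degree n i = sumFin (numVertices n) (adjMatrix n i)

laplacian : (n : ℕ) → Matrix (numVertices n)
laplacian n i j with i ≟ᶠ j
... | yes _ = degree n i - adjMatrix n i j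
... | no  _ = - adjMatrix n i j

laplacianCharPoly : (n : ℕ) → ℤ → ℤ
laplacianCharPoly n x = det (numVertices n) (λ i j → diag i j - laplacian n i j)
  where
  diag : Fin (numVertices n) → Fin (numVertices n) → ℤ
  diag i j with i ≟ᶠ j
  ... | yes _ = x
  ... | no  _ = + 0

module Submission where

-- For vertices x, y of Γ′(ℤ_n) we have x ∈ Ry iff gcd(y, n) ∣ gcd(x, n), so x and y
-- are adjacent exactly when these two divisors of n are incomparable.  For n = p²q
-- the divisors occurring are p, q, p², pq, and incomparability makes them the path
-- p — q — p² — pq: Γ′(ℤ_n) is this path with every divisor d blown up into an
-- independent set of n_d vertices.  The matrix x·I − L of such a blow-up has entries
-- δᵢⱼ α(cᵢ) + β(cᵢ, cⱼ) w_j, where cᵢ is the class of vertex i.  Subtracting the row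
-- of one vertex from that of another vertex of the same class, and adding back the
-- column, leaves α(c) times a matrix of the same shape with these two vertices merged
-- into one of weight w + w′.  Merging down to one vertex per class gives
-- ∏ α(d)^(n_d − 1) times the determinant of the weighted quotient matrix, which is
-- tridiagonal with determinant the continuant l(x).  The class sizes n_d follow from
-- inclusion–exclusion over the multiples of p, q, p², pq and p²q.

open import Data.Nat.Base using (ℕ)
open import Data.Nat.Primality using (Prime)
open import Relation.Binary.PropositionalEquality using (_≢_)

module FinSum where

  open import Defs
  open import Data.Nat.Base using (ℕ; zero; suc)
  open import Data.Integer.Base using (ℤ; +_; -_; _+_; _*_)
  import Data.Integer.Properties as ℤ
  open import Data.Integer.Tactic.RingSolver using (solve-∀)
  open import Data.Fin.Base using (Fin; zero; suc)
  open import Data.Fin.Properties using () renaming (_≟_ to _≟ᶠ_)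
  open import Function.Base using (_∘_)
  open import Function.Definitions using (Injective)
  open import Relation.Nullary using (yes; no)
  open import Relation.Nullary.Negation using (contradiction)
  open import Relation.Binary.PropositionalEquality

  sumFin-cong : ∀ m {f g : Fin m → ℤ} → (∀ i → f i ≡ g i) → sumFin m f ≡ sumFin m g
  sumFin-cong zero    f≗g = refl
  sumFin-cong (suc m) f≗g = cong₂ _+_ (f≗g zero) (sumFin-cong m (f≗g ∘ suc))

  sumFin-zero : ∀ m {f : Fin m → ℤ} → (∀ i → f i ≡ + 0) → sumFin m f ≡ + 0
  sumFin-zero zero    f≗0 = refl
  sumFin-zero (suc m) f≗0 = cong₂ _+_ (f≗0 zero) (sumFin-zero m (f≗0 ∘ suc))

  sumFin-+ : ∀ m (f g : Fin m → ℤ) → sumFin m (λ i → f i + g i) ≡ sumFin m f + sumFin m g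
  sumFin-+ zero    f g = refl
  sumFin-+ (suc m) f g = trans (cong (λ s → f zero + g zero + s) (sumFin-+ m (f ∘ suc) (g ∘ suc)))
                               (interchange (f zero) (g zero) _ _)
    where
    interchange : ∀ a b c d → a + b + (c + d) ≡ a + c + (b + d)
    interchange = solve-∀

  sumFin-*ˡ : ∀ m c (f : Fin m → ℤ) → sumFin m (λ i → c * f i) ≡ c * sumFin m f
  sumFin-*ˡ zero    c f = sym (ℤ.*-zeroʳ c)
  sumFin-*ˡ (suc m) c f = trans (cong (λ s → c * f zero + s) (sumFin-*ˡ m c (f ∘ suc)))
                                (sym (ℤ.*-distribˡ-+ c (f zero) _))

  sumFin-*ˡ² : ∀ m a b (f : Fin m → ℤ) → a * (b * sumFin m f) ≡ sumFin m (λ i → a * (b * f i))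
  sumFin-*ˡ² m a b f = trans (cong (a *_) (sym (sumFin-*ˡ m b f))) (sym (sumFin-*ˡ m a _))

  sumFin-neg : ∀ m (f : Fin m → ℤ) → sumFin m (λ i → - f i) ≡ - sumFin m f
  sumFin-neg zero    f = refl
  sumFin-neg (suc m) f = trans (cong (λ s → - f zero + s) (sumFin-neg m (f ∘ suc)))
                               (sym (ℤ.neg-distrib-+ (f zero) _))

  sumFin-comm : ∀ m k (f : Fin m → Fin k → ℤ) →
    sumFin m (λ i → sumFin k (f i)) ≡ sumFin k (λ j → sumFin m (λ i → f i j))
  sumFin-comm zero    k f = sym (sumFin-zero k (λ _ → refl))
  sumFin-comm (suc m) k f = trans (cong (λ s → sumFin k (f zero) + s) (sumFin-comm m k (f ∘ suc)))
                                  (sym (sumFin-+ k (f zero) _))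

  δ : ∀ {m} → Fin m → Fin m → ℕ
  δ zero    zero    = 1
  δ zero    (suc _) = 0
  δ (suc _) zero    = 0
  δ (suc i) (suc j) = δ i j

  δ-refl : ∀ {m} (i : Fin m) → δ i i ≡ 1
  δ-refl zero    = refl
  δ-refl (suc i) = δ-refl i

  δ-≢ : ∀ {m} {i j : Fin m} → i ≢ j → δ i j ≡ 0
  δ-≢ {i = zero}  {zero}  i≢j = contradiction refl i≢j
  δ-≢ {i = zero}  {suc j} i≢j = refl
  δ-≢ {i = suc i} {zero}  i≢j = refl
  δ-≢ {i = suc i} {suc j} i≢j = δ-≢ (i≢j ∘ cong suc)

  δ-sym : ∀ {m} (i j : Fin m) → δ i j ≡ δ j i
  δ-sym zero    zero    = refl
  δ-sym zero    (suc j) = refl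
  δ-sym (suc i) zero    = refl
  δ-sym (suc i) (suc j) = δ-sym i j

  δ-injective : ∀ {m n} {f : Fin m → Fin n} → Injective _≡_ _≡_ f → ∀ a b → δ (f a) (f b) ≡ δ a b
  δ-injective {f = f} f-inj a b with a ≟ᶠ b
  ... | yes refl = trans (δ-refl (f a)) (sym (δ-refl a))
  ... | no a≢b   = trans (δ-≢ (a≢b ∘ f-inj)) (sym (δ-≢ a≢b))

  sumFin-δ : ∀ m (i : Fin m) (f : Fin m → ℤ) → sumFin m (λ j → + δ j i * f j) ≡ f i
  sumFin-δ (suc m) zero f =
    trans (cong₂ _+_ (ℤ.*-identityˡ (f zero)) (sumFin-zero m (λ _ → refl))) (ℤ.+-identityʳ (f zero))
  sumFin-δ (suc m) (suc i) f = trans (cong (λ s → + 0 + s) (sumFin-δ m i (f ∘ suc))) (ℤ.+-identityˡ _)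


module FinPermutation where

  open import Defs
  open FinSum using (sumFin-cong)
  open import Data.Nat.Base using (zero; suc)
  open import Data.Integer.Base using (ℤ; _+_)
  open import Data.Integer.Tactic.RingSolver using (solve-∀)
  open import Data.Fin.Base using (Fin; zero; suc; punchIn; punchOut; inject₁; lift)
  open import Data.Fin.Properties
    using (suc-injective; punchIn-injective; punchInᵢ≢i; punchIn-punchOut; punchOut-injective)
  open import Data.List.Base using (List; []; _∷_; _++_; map)
  open import Data.Product.Base using (∃; _,_; proj₁; proj₂)
  open import Function.Base using (_∘_; id)
  open import Function.Definitions using (Injective)
  import Function.Construct.Composition as Compose
  open import Relation.Nullary.Negation using (contradiction)
  open import Relation.Binary.PropositionalEquality

  swapAt : ∀ {n} → Fin n → Fin (suc n) → Fin (suc n)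
  swapAt zero    zero          = suc zero
  swapAt zero    (suc zero)    = zero
  swapAt zero    (suc (suc x)) = suc (suc x)
  swapAt (suc k) zero          = zero
  swapAt (suc k) (suc x)       = suc (swapAt k x)

  swapAt-inject₁ : ∀ {n} (k : Fin n) → swapAt k (inject₁ k) ≡ suc k
  swapAt-inject₁ zero    = refl
  swapAt-inject₁ (suc k) = cong suc (swapAt-inject₁ k)

  swapAt-suc : ∀ {n} (k : Fin n) → swapAt k (suc k) ≡ inject₁ k
  swapAt-suc zero    = refl
  swapAt-suc (suc k) = cong suc (swapAt-suc k)

  swapAt-punchIn-inject₁ : ∀ {n} (k b : Fin n) → swapAt k (punchIn (inject₁ k) b) ≡ punchIn (suc k) b
  swapAt-punchIn-inject₁ zero    zero    = refl
  swapAt-punchIn-inject₁ zero    (suc b) = refl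
  swapAt-punchIn-inject₁ (suc k) zero    = refl
  swapAt-punchIn-inject₁ (suc k) (suc b) = cong suc (swapAt-punchIn-inject₁ k b)

  swapAt-punchIn-suc : ∀ {n} (k b : Fin n) → swapAt k (punchIn (suc k) b) ≡ punchIn (inject₁ k) b
  swapAt-punchIn-suc zero    zero    = refl
  swapAt-punchIn-suc zero    (suc b) = refl
  swapAt-punchIn-suc (suc k) zero    = refl
  swapAt-punchIn-suc (suc k) (suc b) = cong suc (swapAt-punchIn-suc k b)

  swapAt-fixes : ∀ {n} (k : Fin n) j → j ≢ inject₁ k → j ≢ suc k → swapAt k j ≡ j
  swapAt-fixes zero    zero          j≢k  _    = contradiction refl j≢k
  swapAt-fixes zero    (suc zero)    _    j≢k′ = contradiction refl j≢k′
  swapAt-fixes zero    (suc (suc j)) _    _    = refl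
  swapAt-fixes (suc k) zero          _    _    = refl
  swapAt-fixes (suc k) (suc j)       j≢k  j≢k′ = cong suc (swapAt-fixes k j (j≢k ∘ cong suc) (j≢k′ ∘ cong suc))

  swapAt-punchIn : ∀ {n} (k : Fin (suc n)) j → j ≢ inject₁ k → j ≢ suc k →
    ∃ λ (k′ : Fin n) → ∀ b → swapAt k (punchIn j b) ≡ punchIn j (swapAt k′ b)
  swapAt-punchIn         zero    zero          j≢k _    = contradiction refl j≢k
  swapAt-punchIn         zero    (suc zero)    _   j≢k′ = contradiction refl j≢k′
  swapAt-punchIn {zero}  zero    (suc (suc ()))
  swapAt-punchIn {suc n} zero    (suc (suc j)) _   _    =
    zero , λ { zero → refl ; (suc zero) → refl ; (suc (suc b)) → refl }
  swapAt-punchIn {suc n} (suc k) zero          _   _    = k , λ b → refl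
  swapAt-punchIn {suc n} (suc k) (suc j)       j≢k j≢k′
    with k′ , commute ← swapAt-punchIn k j (j≢k ∘ cong suc) (j≢k′ ∘ cong suc)
    = suc k′ , λ { zero → refl ; (suc b) → cong suc (commute b) }

  applySwaps : ∀ {n} → List (Fin n) → Fin (suc n) → Fin (suc n)
  applySwaps []       = id
  applySwaps (k ∷ ks) = swapAt k ∘ applySwaps ks

  applySwaps-++ : ∀ {n} (ks ls : List (Fin n)) x → applySwaps (ks ++ ls) x ≡ applySwaps ks (applySwaps ls x)
  applySwaps-++ []       ls x = refl
  applySwaps-++ (k ∷ ks) ls x = cong (swapAt k) (applySwaps-++ ks ls x)

  applySwaps-map-suc : ∀ {n} (ks : List (Fin n)) x → applySwaps (map suc ks) x ≡ lift 1 (applySwaps ks) x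
  applySwaps-map-suc []       zero    = refl
  applySwaps-map-suc []       (suc x) = refl
  applySwaps-map-suc (k ∷ ks) zero    = cong (swapAt (suc k)) (applySwaps-map-suc ks zero)
  applySwaps-map-suc (k ∷ ks) (suc x) = cong (swapAt (suc k)) (applySwaps-map-suc ks (suc x))

  rotate : ∀ {n} → Fin (suc n) → Fin (suc n) → Fin (suc n)
  rotate i zero    = i
  rotate i (suc a) = punchIn i a

  rotationSwaps : ∀ {n} → Fin (suc n) → List (Fin n)
  rotationSwaps             zero    = []
  rotationSwaps {n = suc _} (suc i) = map suc (rotationSwaps i) ++ zero ∷ []

  rotate-swaps : ∀ {n} (i : Fin (suc n)) x → rotate i x ≡ applySwaps (rotationSwaps i) x
  rotate-swaps             zero    zero    = refl
  rotate-swaps             zero    (suc x) = refl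
  rotate-swaps {n = suc _} (suc i) x = begin
    rotate (suc i) x                                         ≡⟨ rotate-suc x ⟩
    lift 1 (rotate i) (swapAt zero x)                        ≡⟨ lift-cong (swapAt zero x) ⟩
    lift 1 (applySwaps (rotationSwaps i)) (swapAt zero x)    ≡⟨ applySwaps-map-suc (rotationSwaps i) _ ⟨
    applySwaps (map suc (rotationSwaps i)) (swapAt zero x)   ≡⟨ applySwaps-++ (map suc (rotationSwaps i)) (zero ∷ []) x ⟨
    applySwaps (rotationSwaps (suc i)) x                     ∎
    where
    open ≡-Reasoning
    rotate-suc : ∀ x → rotate (suc i) x ≡ lift 1 (rotate i) (swapAt zero x)
    rotate-suc zero          = refl
    rotate-suc (suc zero)    = refl
    rotate-suc (suc (suc a)) = refl
    lift-cong : ∀ y → lift 1 (rotate i) y ≡ lift 1 (applySwaps (rotationSwaps i)) y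
    lift-cong zero    = refl
    lift-cong (suc y) = cong suc (rotate-swaps i y)

  rotate-injective : ∀ {n} (i : Fin (suc n)) → Injective _≡_ _≡_ (rotate i)
  rotate-injective i {zero}  {zero}  _ = refl
  rotate-injective i {zero}  {suc b} e = contradiction (sym e) (punchInᵢ≢i i b)
  rotate-injective i {suc a} {zero}  e = contradiction e (punchInᵢ≢i i a)
  rotate-injective i {suc a} {suc b} e = cong suc (punchIn-injective i a b e)

  lift₁-injective : ∀ {n} {f : Fin n → Fin n} → Injective _≡_ _≡_ f → Injective _≡_ _≡_ (lift 1 f)
  lift₁-injective f-inj {zero}  {zero}  _ = refl
  lift₁-injective f-inj {suc a} {suc b} e = cong suc (f-inj (suc-injective e))

  pairToFront : ∀ {n} {i j : Fin (suc (suc n))} → i ≢ j → Fin (suc (suc n)) → Fin (suc (suc n))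
  pairToFront {i = i} i≢j = rotate i ∘ lift 1 (rotate (punchOut i≢j))

  pairToFront-injective : ∀ {n} {i j : Fin (suc (suc n))} (i≢j : i ≢ j) → Injective _≡_ _≡_ (pairToFront i≢j)
  pairToFront-injective {i = i} i≢j =
    Compose.injective _≡_ _≡_ _≡_ (lift₁-injective (rotate-injective (punchOut i≢j))) (rotate-injective i)

  pairToFront-one : ∀ {n} {i j : Fin (suc (suc n))} (i≢j : i ≢ j) → pairToFront i≢j (suc zero) ≡ j
  pairToFront-one i≢j = punchIn-punchOut i≢j

  injective⇒swaps : ∀ n {σ : Fin (suc n) → Fin (suc n)} → Injective _≡_ _≡_ σ →
    ∃ λ ks → ∀ x → σ x ≡ applySwaps ks x
  injective⇒swaps zero    {σ} σ-inj = [] , λ { zero → Fin1-zero (σ zero) }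
    where
    Fin1-zero : (a : Fin 1) → a ≡ zero
    Fin1-zero zero = refl
  -- σ = rotate (σ 0) ∘ lift 1 τ, where τ is σ on the other points with σ 0 punched out.
  injective⇒swaps (suc n) {σ} σ-inj = rotationSwaps (σ zero) ++ map suc ks , λ x → begin
    σ x                                                             ≡⟨ σ-factor x ⟩
    rotate (σ zero) (lift 1 τ x)                                    ≡⟨ rotate-swaps (σ zero) _ ⟩
    applySwaps (rotationSwaps (σ zero)) (lift 1 τ x)                ≡⟨ cong (applySwaps (rotationSwaps (σ zero))) (lift-swaps x) ⟩
    applySwaps (rotationSwaps (σ zero)) (applySwaps (map suc ks) x) ≡⟨ applySwaps-++ (rotationSwaps (σ zero)) _ x ⟨
    applySwaps (rotationSwaps (σ zero) ++ map suc ks) x             ∎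
    where
    open ≡-Reasoning
    σ₀≢σₛ : ∀ a → σ zero ≢ σ (suc a)
    σ₀≢σₛ a e with () ← σ-inj e
    τ : Fin (suc n) → Fin (suc n)
    τ a = punchOut (σ₀≢σₛ a)
    τ-inj : Injective _≡_ _≡_ τ
    τ-inj e = suc-injective (σ-inj (punchOut-injective (σ₀≢σₛ _) (σ₀≢σₛ _) e))
    σ-factor : ∀ x → σ x ≡ rotate (σ zero) (lift 1 τ x)
    σ-factor zero    = refl
    σ-factor (suc a) = sym (punchIn-punchOut (σ₀≢σₛ a))
    ks = proj₁ (injective⇒swaps n τ-inj)
    τ≗ks = proj₂ (injective⇒swaps n τ-inj)
    lift-swaps : ∀ x → lift 1 τ x ≡ applySwaps (map suc ks) x
    lift-swaps zero    = sym (applySwaps-map-suc ks zero)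
    lift-swaps (suc a) = trans (cong suc (τ≗ks a)) (sym (applySwaps-map-suc ks (suc a)))

  sumFin-swapAt : ∀ n (k : Fin n) (f : Fin (suc n) → ℤ) → sumFin (suc n) (f ∘ swapAt k) ≡ sumFin (suc n) f
  sumFin-swapAt (suc n) zero    f = left-comm (f (suc zero)) (f zero) _
    where
    left-comm : ∀ a b c → a + (b + c) ≡ b + (a + c)
    left-comm = solve-∀
  sumFin-swapAt (suc n) (suc k) f = cong (λ s → f zero + s) (sumFin-swapAt n k (f ∘ suc))

  sumFin-relabel-swaps : ∀ n (ks : List (Fin n)) (f : Fin (suc n) → ℤ) →
    sumFin (suc n) (f ∘ applySwaps ks) ≡ sumFin (suc n) f
  sumFin-relabel-swaps n []       f = refl
  sumFin-relabel-swaps n (k ∷ ks) f = trans (sumFin-relabel-swaps n ks (f ∘ swapAt k)) (sumFin-swapAt n k f)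

  sumFin-relabel : ∀ n {σ : Fin n → Fin n} → Injective _≡_ _≡_ σ → (f : Fin n → ℤ) →
    sumFin n (f ∘ σ) ≡ sumFin n f
  sumFin-relabel zero    σ-inj f = refl
  sumFin-relabel (suc n) σ-inj f with ks , σ≗ks ← injective⇒swaps n σ-inj =
    trans (sumFin-cong (suc n) (cong f ∘ σ≗ks)) (sumFin-relabel-swaps n ks f)


module Determinant where

  open import Defs
  open FinSum
  open FinPermutation
  open import Data.Nat.Base using (zero; suc)
  open import Data.Integer.Base using (ℤ; +_; -_; _+_; _*_; _-_; _^_; +[1+_]; -[1+_])
  import Data.Integer.Properties as ℤ
  open import Data.Integer.Tactic.RingSolver using (solve-∀)
  open import Data.Fin.Base using (Fin; zero; suc; toℕ; punchIn; punchOut; inject₁)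
  open import Data.Fin.Properties using (punchIn-injective; punchInᵢ≢i; punchIn-punchOut; toℕ-inject₁)
    renaming (_≟_ to _≟ᶠ_)
  open import Data.List.Base using (List; []; _∷_)
  open import Data.Product.Base using (_,_)
  open import Function.Base using (_∘_)
  open import Function.Definitions using (Injective)
  open import Relation.Nullary using (yes; no)
  open import Relation.Nullary.Negation using (contradiction)
  open import Relation.Binary.PropositionalEquality

  sgn : ∀ {m} → Fin m → ℤ
  sgn j = (- + 1) ^ toℕ j

  sgn-suc : ∀ {n} (k : Fin n) → sgn {suc n} (suc k) ≡ - sgn (inject₁ k)
  sgn-suc k = trans (ℤ.-1*i≡-i _) (cong (λ e → - ((- + 1) ^ e)) (sym (toℕ-inject₁ k)))

  minor : ∀ {m} → Matrix (suc m) → Fin (suc m) → Matrix m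
  minor M j a b = M (suc a) (punchIn j b)

  laplaceTerm : ∀ {m} → Matrix (suc m) → Fin (suc m) → ℤ
  laplaceTerm {m} M j = sgn j * (M zero j * det m (minor M j))

  det-cong : ∀ m {M N : Matrix m} → (∀ i j → M i j ≡ N i j) → det m M ≡ det m N
  det-cong zero    M≗N = refl
  det-cong (suc m) M≗N = sumFin-cong (suc m) λ j →
    cong₂ (λ a d → sgn j * (a * d)) (M≗N zero j) (det-cong m λ a b → M≗N (suc a) (punchIn j b))

  module _ {m} (A B C : Matrix (suc m)) (t : ℤ) where

    det-linear-termwise : (∀ j → laplaceTerm A j ≡ laplaceTerm B j + t * laplaceTerm C j) →
                          det (suc m) A ≡ det (suc m) B + t * det (suc m) C
    det-linear-termwise terms = begin
      sumFin (suc m) (laplaceTerm A)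
        ≡⟨ sumFin-cong (suc m) terms ⟩
      sumFin (suc m) (λ j → laplaceTerm B j + t * laplaceTerm C j)
        ≡⟨ sumFin-+ (suc m) (laplaceTerm B) (λ j → t * laplaceTerm C j) ⟩
      det (suc m) B + sumFin (suc m) (λ j → t * laplaceTerm C j)
        ≡⟨ cong (λ s → det (suc m) B + s) (sumFin-*ˡ (suc m) t (laplaceTerm C)) ⟩
      det (suc m) B + t * det (suc m) C ∎
      where open ≡-Reasoning

    laplaceTerm-linear-entry : ∀ j → A zero j ≡ B zero j + t * C zero j →
      (∀ a b → minor A j a b ≡ minor B j a b) → (∀ a b → minor A j a b ≡ minor C j a b) →
      laplaceTerm A j ≡ laplaceTerm B j + t * laplaceTerm C j
    laplaceTerm-linear-entry j entry A≗B A≗C = begin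
      sgn j * (A zero j * det m (minor A j))
        ≡⟨ cong₂ (λ a d → sgn j * (a * d)) entry (det-cong m A≗B) ⟩
      sgn j * ((B zero j + t * C zero j) * det m (minor B j))
        ≡⟨ distrib (sgn j) (B zero j) (C zero j) t _ ⟩
      laplaceTerm B j + t * (sgn j * (C zero j * det m (minor B j)))
        ≡⟨ cong (λ d → laplaceTerm B j + t * (sgn j * (C zero j * d)))
                (det-cong m λ a b → trans (sym (A≗B a b)) (A≗C a b)) ⟩
      laplaceTerm B j + t * laplaceTerm C j ∎
      where
      open ≡-Reasoning
      distrib : ∀ s b c t d → s * ((b + t * c) * d) ≡ s * (b * d) + t * (s * (c * d))
      distrib = solve-∀

    laplaceTerm-linear-minor : ∀ j → A zero j ≡ B zero j → A zero j ≡ C zero j →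
      det m (minor A j) ≡ det m (minor B j) + t * det m (minor C j) →
      laplaceTerm A j ≡ laplaceTerm B j + t * laplaceTerm C j
    laplaceTerm-linear-minor j A≡B A≡C minors = begin
      sgn j * (A zero j * det m (minor A j))
        ≡⟨ cong (λ d → sgn j * (A zero j * d)) minors ⟩
      sgn j * (A zero j * (det m (minor B j) + t * det m (minor C j)))
        ≡⟨ distrib (sgn j) (A zero j) _ _ t ⟩
      sgn j * (A zero j * det m (minor B j)) + t * (sgn j * (A zero j * det m (minor C j)))
        ≡⟨ cong₂ (λ b c → sgn j * (b * det m (minor B j)) + t * (sgn j * (c * det m (minor C j)))) A≡B A≡C ⟩
      laplaceTerm B j + t * laplaceTerm C j ∎
      where
      open ≡-Reasoning
      distrib : ∀ s a d e t → s * (a * (d + t * e)) ≡ s * (a * d) + t * (s * (a * e))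
      distrib = solve-∀

  det-linear-row₀ : ∀ m (A B C : Matrix (suc m)) t →
    (∀ j → A zero j ≡ B zero j + t * C zero j) →
    (∀ i j → A (suc i) j ≡ B (suc i) j) → (∀ i j → A (suc i) j ≡ C (suc i) j) →
    det (suc m) A ≡ det (suc m) B + t * det (suc m) C
  det-linear-row₀ m A B C t row₀ A≗B A≗C = det-linear-termwise A B C t λ j →
    laplaceTerm-linear-entry A B C t j (row₀ j) (λ a b → A≗B a (punchIn j b)) (λ a b → A≗C a (punchIn j b))

  det-linear-col : ∀ m (k : Fin m) (A B C : Matrix m) t →
    (∀ i → A i k ≡ B i k + t * C i k) →
    (∀ i j → j ≢ k → A i j ≡ B i j) → (∀ i j → j ≢ k → A i j ≡ C i j) →
    det m A ≡ det m B + t * det m C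
  det-linear-col (suc m) k A B C t colₖ A≗B A≗C = det-linear-termwise A B C t term
    where
    term : ∀ j → laplaceTerm A j ≡ laplaceTerm B j + t * laplaceTerm C j
    term j with j ≟ᶠ k
    ... | yes refl = laplaceTerm-linear-entry A B C t j (colₖ zero)
                       (λ a b → A≗B (suc a) (punchIn j b) (punchInᵢ≢i j b))
                       (λ a b → A≗C (suc a) (punchIn j b) (punchInᵢ≢i j b))
    ... | no j≢k = laplaceTerm-linear-minor A B C t j (A≗B zero j j≢k) (A≗C zero j j≢k)
                     (det-linear-col m k′ (minor A j) (minor B j) (minor C j) t colₖ′ (rest {B} A≗B) (rest {C} A≗C))
      where
      k′ = punchOut j≢k
      colₖ′ : ∀ a → minor A j a k′ ≡ minor B j a k′ + t * minor C j a k′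
      colₖ′ a = subst (λ l → A (suc a) l ≡ B (suc a) l + t * C (suc a) l)
                      (sym (punchIn-punchOut j≢k)) (colₖ (suc a))
      rest : ∀ {N} → (∀ i j → j ≢ k → A i j ≡ N i j) → ∀ a b → b ≢ k′ → minor A j a b ≡ N (suc a) (punchIn j b)
      rest A≗N a b b≢k′ = A≗N (suc a) (punchIn j b)
        (λ e → b≢k′ (punchIn-injective j b k′ (trans e (sym (punchIn-punchOut j≢k)))))

  det-row₀-sparse : ∀ m (M : Matrix (suc m)) → (∀ j → M zero (suc j) ≡ + 0) →
    det (suc m) M ≡ M zero zero * det m (λ a b → M (suc a) (suc b))
  det-row₀-sparse m M row₀ = begin
    laplaceTerm M zero + sumFin m (laplaceTerm M ∘ suc)
      ≡⟨ cong₂ _+_ (ℤ.*-identityˡ (M zero zero * det m (minor M zero))) (sumFin-zero m vanishing) ⟩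
    M zero zero * det m (minor M zero) + + 0
      ≡⟨ ℤ.+-identityʳ _ ⟩
    M zero zero * det m (λ a b → M (suc a) (suc b)) ∎
    where
    open ≡-Reasoning
    vanishing : ∀ j → laplaceTerm M (suc j) ≡ + 0
    vanishing j = trans (cong (λ a → sgn (suc j) * (a * det m (minor M (suc j)))) (row₀ j))
                        (ℤ.*-zeroʳ (sgn (suc j)))

  -- The Laplace terms of the two swapped columns are exchanged up to the sign of
  -- their position; every other term contains a column swap of its own minor.
  det-swapCols : ∀ n (k : Fin n) (M : Matrix (suc n)) →
    det (suc n) (λ i j → M i (swapAt k j)) ≡ - det (suc n) M
  det-swapCols (suc n) k M = begin
    sumFin (suc (suc n)) (laplaceTerm M′)
      ≡⟨ sumFin-cong (suc (suc n)) term ⟩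
    sumFin (suc (suc n)) (λ j → - laplaceTerm M (swapAt k j))
      ≡⟨ sumFin-neg (suc (suc n)) (laplaceTerm M ∘ swapAt k) ⟩
    - sumFin (suc (suc n)) (laplaceTerm M ∘ swapAt k)
      ≡⟨ cong -_ (sumFin-swapAt (suc n) k (laplaceTerm M)) ⟩
    - det (suc (suc n)) M ∎
    where
    open ≡-Reasoning
    M′ : Matrix (suc (suc n))
    M′ i j = M i (swapAt k j)
    flip-sign : ∀ i j → sgn i ≡ - sgn j → M zero (swapAt k i) ≡ M zero j →
                (∀ a b → minor M′ i a b ≡ minor M j a b) → laplaceTerm M′ i ≡ - laplaceTerm M j
    flip-sign i j sgns entry minors = trans
      (cong₂ (λ s e → s * (e * det (suc n) (minor M′ i))) sgns entry)
      (trans (negate (sgn j) (M zero j) _) (cong (λ d → - (sgn j * (M zero j * d))) (det-cong (suc n) minors)))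
      where
      negate : ∀ s a d → (- s) * (a * d) ≡ - (s * (a * d))
      negate = solve-∀
    term : ∀ j → laplaceTerm M′ j ≡ - laplaceTerm M (swapAt k j)
    term j with j ≟ᶠ inject₁ k | j ≟ᶠ suc k
    ... | yes refl | _ = subst (λ l → laplaceTerm M′ j ≡ - laplaceTerm M l) (sym (swapAt-inject₁ k))
      (flip-sign j (suc k) (trans (sym (ℤ.neg-involutive _)) (cong -_ (sym (sgn-suc k))))
        (cong (M zero) (swapAt-inject₁ k)) (λ a b → cong (M (suc a)) (swapAt-punchIn-inject₁ k b)))
    ... | no _ | yes refl = subst (λ l → laplaceTerm M′ j ≡ - laplaceTerm M l) (sym (swapAt-suc k))
      (flip-sign j (inject₁ k) (sgn-suc k)
        (cong (M zero) (swapAt-suc k)) (λ a b → cong (M (suc a)) (swapAt-punchIn-suc k b)))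
    ... | no j≢k | no j≢k′ with k′ , commute ← swapAt-punchIn k j j≢k j≢k′ rewrite swapAt-fixes k j j≢k j≢k′ = begin
      sgn j * (M zero j * det (suc n) (minor M′ j))
        ≡⟨ cong (λ d → sgn j * (M zero j * d))
                (trans (det-cong (suc n) λ a b → cong (M (suc a)) (commute b)) (det-swapCols n k′ (minor M j))) ⟩
      sgn j * (M zero j * - det (suc n) (minor M j))
        ≡⟨ negate (sgn j) (M zero j) _ ⟩
      - laplaceTerm M j ∎
      where
      negate : ∀ s a d → s * (a * (- d)) ≡ - (s * (a * d))
      negate = solve-∀

  -- Both sides expand into the same double sum over row 0, column 0 and the
  -- complementary (m - 1)-minors.
  det-expand-col₀ : ∀ m (M : Matrix (suc m)) →
    det (suc m) M ≡ sumFin (suc m) (λ i → sgn i * (M i zero * det m (λ a b → M (punchIn i a) (suc b))))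
  det-expand-col₀ zero    M = refl
  det-expand-col₀ (suc m) M = cong (λ s → laplaceTerm M zero + s) (begin
    sumFin (suc m) (λ j → sgn (suc j) * (A j * det (suc m) (minor M (suc j))))
      ≡⟨ sumFin-cong (suc m) (λ j → cong (λ d → sgn (suc j) * (A j * d)) (det-expand-col₀ m (minor M (suc j)))) ⟩
    sumFin (suc m) (λ j → sgn (suc j) * (A j * sumFin (suc m) (λ i → sgn i * (B i * X i j))))
      ≡⟨ sumFin-cong (suc m) (λ j → sumFin-*ˡ² (suc m) (sgn (suc j)) (A j) (λ i → sgn i * (B i * X i j))) ⟩
    sumFin (suc m) (λ j → sumFin (suc m) (λ i → sgn (suc j) * (A j * (sgn i * (B i * X i j)))))
      ≡⟨ sumFin-comm (suc m) (suc m) (λ j i → sgn (suc j) * (A j * (sgn i * (B i * X i j)))) ⟩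
    sumFin (suc m) (λ i → sumFin (suc m) (λ j → sgn (suc j) * (A j * (sgn i * (B i * X i j)))))
      ≡⟨ sumFin-cong (suc m) (λ i → sumFin-cong (suc m) (λ j → reorder (sgn j) (sgn i) (A j) (B i) (X i j))) ⟩
    sumFin (suc m) (λ i → sumFin (suc m) (λ j → sgn (suc i) * (B i * (sgn j * (A j * X i j)))))
      ≡⟨ sumFin-cong (suc m) (λ i → sym (sumFin-*ˡ² (suc m) (sgn (suc i)) (B i) (λ j → sgn j * (A j * X i j)))) ⟩
    sumFin (suc m) (λ i → sgn (suc i) * (B i * det (suc m) (λ a b → M (punchIn (suc i) a) (suc b)))) ∎)
    where
    open ≡-Reasoning
    A B : Fin (suc m) → ℤ
    A j = M zero (suc j)
    B i = M (suc i) zero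
    X : Fin (suc m) → Fin (suc m) → ℤ
    X i j = det m (λ a b → M (suc (punchIn i a)) (suc (punchIn j b)))
    -- sgn (suc j) unfolds to - + 1 * sgn j.
    reorder : ∀ sⱼ sᵢ a b x → (- + 1 * sⱼ) * (a * (sᵢ * (b * x))) ≡ (- + 1 * sᵢ) * (b * (sⱼ * (a * x)))
    reorder = solve-∀

  det-transpose : ∀ m (M : Matrix m) → det m (λ i j → M j i) ≡ det m M
  det-transpose zero    M = refl
  det-transpose (suc m) M = trans
    (sumFin-cong (suc m) λ j → cong (λ d → sgn j * (M j zero * d)) (det-transpose m (λ a b → M (punchIn j a) (suc b))))
    (sym (det-expand-col₀ m M))

  i≡-i⇒i≡0 : ∀ x → x ≡ - x → x ≡ + 0
  i≡-i⇒i≡0 (+ zero)  _  = refl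
  i≡-i⇒i≡0 +[1+ n ] ()
  i≡-i⇒i≡0 -[1+ n ] ()

  det-equalCols₀₁ : ∀ m (M : Matrix (suc (suc m))) → (∀ i → M i zero ≡ M i (suc zero)) → det (suc (suc m)) M ≡ + 0
  det-equalCols₀₁ m M cols = i≡-i⇒i≡0 _ (trans (det-cong (suc (suc m)) swapped) (det-swapCols (suc m) zero M))
    where
    swapped : ∀ i j → M i j ≡ M i (swapAt zero j)
    swapped i zero          = cols i
    swapped i (suc zero)    = sym (cols i)
    swapped i (suc (suc j)) = refl

  det-equalRows₀₁ : ∀ m (M : Matrix (suc (suc m))) → (∀ j → M zero j ≡ M (suc zero) j) → det (suc (suc m)) M ≡ + 0
  det-equalRows₀₁ m M rows = trans (sym (det-transpose _ M)) (det-equalCols₀₁ m (λ i j → M j i) rows)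

  subtractRow₁ : ∀ {m} → Matrix (suc (suc m)) → Matrix (suc (suc m))
  subtractRow₁ M zero    j = M zero j - M (suc zero) j
  subtractRow₁ M (suc i) j = M (suc i) j

  det-subtractRow₁ : ∀ m (M : Matrix (suc (suc m))) → det (suc (suc m)) (subtractRow₁ M) ≡ det (suc (suc m)) M
  det-subtractRow₁ m M = begin
    det (suc (suc m)) (subtractRow₁ M)
      ≡⟨ det-linear-row₀ (suc m) (subtractRow₁ M) M R (- + 1)
           (λ j → cong (λ x → M zero j + x) (sym (ℤ.-1*i≡-i _))) (λ _ _ → refl) (λ _ _ → refl) ⟩
    det (suc (suc m)) M + - + 1 * det (suc (suc m)) R
      ≡⟨ cong (λ d → det (suc (suc m)) M + - + 1 * d) (det-equalRows₀₁ m R (λ _ → refl)) ⟩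
    det (suc (suc m)) M + - + 1 * + 0
      ≡⟨ vanish _ ⟩
    det (suc (suc m)) M ∎
    where
    open ≡-Reasoning
    R : Matrix (suc (suc m))
    R zero    j = M (suc zero) j
    R (suc i) j = M (suc i) j
    vanish : ∀ x → x + - + 1 * + 0 ≡ x
    vanish = solve-∀

  addColumn₀ : ∀ {m} → Matrix (suc (suc m)) → Matrix (suc (suc m))
  addColumn₀ M i zero          = M i zero
  addColumn₀ M i (suc zero)    = M i (suc zero) + M i zero
  addColumn₀ M i (suc (suc j)) = M i (suc (suc j))

  det-addColumn₀ : ∀ m (M : Matrix (suc (suc m))) → det (suc (suc m)) (addColumn₀ M) ≡ det (suc (suc m)) M
  det-addColumn₀ m M = begin
    det (suc (suc m)) (addColumn₀ M)
      ≡⟨ det-linear-col (suc (suc m)) (suc zero) (addColumn₀ M) M C (+ 1)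
           (λ i → cong (λ x → M i (suc zero) + x) (sym (ℤ.*-identityˡ _))) elsewhere-M elsewhere-C ⟩
    det (suc (suc m)) M + + 1 * det (suc (suc m)) C
      ≡⟨ cong (λ d → det (suc (suc m)) M + + 1 * d) (det-equalCols₀₁ m C (λ _ → refl)) ⟩
    det (suc (suc m)) M + + 1 * + 0
      ≡⟨ vanish _ ⟩
    det (suc (suc m)) M ∎
    where
    open ≡-Reasoning
    C : Matrix (suc (suc m))
    C i zero          = M i zero
    C i (suc zero)    = M i zero
    C i (suc (suc j)) = M i (suc (suc j))
    elsewhere-M : ∀ i j → j ≢ suc zero → addColumn₀ M i j ≡ M i j
    elsewhere-M i zero          _   = refl
    elsewhere-M i (suc zero)    j≢1 = contradiction refl j≢1
    elsewhere-M i (suc (suc j)) _   = refl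
    elsewhere-C : ∀ i j → j ≢ suc zero → addColumn₀ M i j ≡ C i j
    elsewhere-C i zero          _   = refl
    elsewhere-C i (suc zero)    j≢1 = contradiction refl j≢1
    elsewhere-C i (suc (suc j)) _   = refl
    vanish : ∀ x → x + + 1 * + 0 ≡ x
    vanish = solve-∀

  det-relabel-swapAt : ∀ n (k : Fin n) (M : Matrix (suc n)) →
    det (suc n) (λ a b → M (swapAt k a) (swapAt k b)) ≡ det (suc n) M
  det-relabel-swapAt n k M = begin
    det (suc n) (λ a b → M (swapAt k a) (swapAt k b)) ≡⟨ det-swapCols n k (λ a b → M (swapAt k a) b) ⟩
    - det (suc n) (λ a b → M (swapAt k a) b)          ≡⟨ cong -_ (det-transpose (suc n) (λ a b → M (swapAt k b) a)) ⟩
    - det (suc n) (λ a b → M (swapAt k b) a)          ≡⟨ cong -_ (det-swapCols n k (λ a b → M b a)) ⟩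
    - - det (suc n) (λ a b → M b a)                   ≡⟨ ℤ.neg-involutive _ ⟩
    det (suc n) (λ a b → M b a)                       ≡⟨ det-transpose (suc n) M ⟩
    det (suc n) M                                     ∎
    where open ≡-Reasoning

  det-relabel-swaps : ∀ n (ks : List (Fin n)) (M : Matrix (suc n)) →
    det (suc n) (λ a b → M (applySwaps ks a) (applySwaps ks b)) ≡ det (suc n) M
  det-relabel-swaps n []       M = refl
  det-relabel-swaps n (k ∷ ks) M =
    trans (det-relabel-swaps n ks (λ a b → M (swapAt k a) (swapAt k b))) (det-relabel-swapAt n k M)

  det-relabel : ∀ n {σ : Fin n → Fin n} → Injective _≡_ _≡_ σ → (M : Matrix n) →
    det n (λ a b → M (σ a) (σ b)) ≡ det n M
  det-relabel zero    σ-inj M = refl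
  det-relabel (suc n) σ-inj M with ks , σ≗ks ← injective⇒swaps n σ-inj =
    trans (det-cong (suc n) λ a b → cong₂ M (σ≗ks a) (σ≗ks b)) (det-relabel-swaps n ks M)


module ClassMatrix where

  open import Defs
  open FinSum
  open FinPermutation
  open Determinant
  open import Data.Nat.Base as ℕ using (ℕ; zero; suc; _∸_; _≤_; s≤s)
  import Data.Nat.Properties as ℕ
  open import Data.Integer.Base using (ℤ; +_; _+_; _*_; _-_; _^_)
  import Data.Integer.Properties as ℤ
  open import Data.Integer.Tactic.RingSolver using (solve-∀)
  open import Data.Fin.Base using (Fin; zero; suc)
  open import Data.Fin.Properties using (any?; injective⇒≤) renaming (_≟_ to _≟ᶠ_)
  open import Data.Product.Base using (∃; _×_; _,_; proj₁; proj₂)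
  open import Data.Vec.Functional using (_∷_)
  open import Function.Base using (_∘_; id)
  open import Function.Definitions using (Injective)
  open import Relation.Nullary using (yes; no; ¬_; Dec; ¬?; _×-dec_)
  open import Relation.Nullary.Negation using (contradiction)
  open import Relation.Binary.PropositionalEquality

  classMatrix : ∀ {K m} → (Fin K → ℤ) → (Fin K → Fin K → ℤ) → (Fin m → Fin K) → (Fin m → ℤ) → Matrix m
  classMatrix α β c w i j = + δ i j * α (c i) + β (c i) (c j) * w j

  classWeight : ∀ {K m} → (Fin m → Fin K) → (Fin m → ℤ) → Fin K → ℤ
  classWeight {m = m} c w k = sumFin m (λ j → + δ (c j) k * w j)

  classSize : ∀ {K m} → (Fin m → Fin K) → Fin K → ℕ
  classSize {m = zero}  c k = 0
  classSize {m = suc m} c k = δ (c zero) k ℕ.+ classSize (c ∘ suc) k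

  module _ {K m} {c c′ : Fin m → Fin K} (c≗c′ : ∀ i → c i ≡ c′ i) where

    classMatrix-cong : ∀ α β {w w′ : Fin m → ℤ} → (∀ i → w i ≡ w′ i) →
                       ∀ i j → classMatrix α β c w i j ≡ classMatrix α β c′ w′ i j
    classMatrix-cong α β w≗w′ i j =
      cong₂ _+_ (cong (λ k → + δ i j * α k) (c≗c′ i)) (cong₂ _*_ (cong₂ β (c≗c′ i) (c≗c′ j)) (w≗w′ j))

    classWeight-cong : ∀ {w w′ : Fin m → ℤ} → (∀ i → w i ≡ w′ i) → ∀ k → classWeight c w k ≡ classWeight c′ w′ k
    classWeight-cong w≗w′ k = sumFin-cong m λ j → cong₂ (λ l v → + δ l k * v) (c≗c′ j) (w≗w′ j)

  classSize-cong : ∀ {K m} {c c′ : Fin m → Fin K} → (∀ i → c i ≡ c′ i) → ∀ k → classSize c k ≡ classSize c′ k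
  classSize-cong {m = zero}  c≗c′ k = refl
  classSize-cong {m = suc m} c≗c′ k = cong₂ ℕ._+_ (cong (λ l → δ l k) (c≗c′ zero)) (classSize-cong (c≗c′ ∘ suc) k)

  classSize-weight : ∀ {K m} (c : Fin m → Fin K) k → + classSize c k ≡ classWeight c (λ _ → + 1) k
  classSize-weight {m = zero}  c k = refl
  classSize-weight {m = suc m} c k =
    trans (ℤ.pos-+ (δ (c zero) k) (classSize (c ∘ suc) k))
          (cong₂ _+_ (sym (ℤ.*-identityʳ (+ δ (c zero) k))) (classSize-weight (c ∘ suc) k))

  sumFin-byClass : ∀ {K m} (c : Fin m → Fin K) (f : Fin K → ℤ) →
    sumFin m (λ j → f (c j)) ≡ sumFin K (λ k → f k * + classSize c k)
  sumFin-byClass {K} {m} c f = sym (begin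
    sumFin K (λ k → f k * + classSize c k)
      ≡⟨ sumFin-cong K (λ k → cong (f k *_) (classSize-weight c k)) ⟩
    sumFin K (λ k → f k * sumFin m (λ j → + δ (c j) k * + 1))
      ≡⟨ sumFin-cong K (λ k → sym (sumFin-*ˡ m (f k) (λ j → + δ (c j) k * + 1))) ⟩
    sumFin K (λ k → sumFin m (λ j → f k * (+ δ (c j) k * + 1)))
      ≡⟨ sumFin-comm K m (λ k j → f k * (+ δ (c j) k * + 1)) ⟩
    sumFin m (λ j → sumFin K (λ k → f k * (+ δ (c j) k * + 1)))
      ≡⟨ sumFin-cong m (λ j → trans (sumFin-cong K (λ k → sift (f k) (c j) k)) (sumFin-δ K (c j) f)) ⟩
    sumFin m (λ j → f (c j)) ∎)
    where
    open ≡-Reasoning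
    swap : ∀ a d → a * (d * + 1) ≡ d * a
    swap = solve-∀
    sift : ∀ a (i k : Fin K) → a * (+ δ i k * + 1) ≡ + δ k i * a
    sift a i k = trans (swap a (+ δ i k)) (cong (λ d → + d * a) (δ-sym i k))

  classWeight-injective : ∀ {K m} {c : Fin m → Fin K} → Injective _≡_ _≡_ c → ∀ w i → classWeight c w (c i) ≡ w i
  classWeight-injective {m = m} c-inj w i =
    trans (sumFin-cong m λ j → cong (λ d → + d * w j) (δ-injective c-inj j i)) (sumFin-δ m i w)

  module _ {m} {σ : Fin m → Fin m} (σ-inj : Injective _≡_ _≡_ σ) where

    classWeight-relabel : ∀ {K} (c : Fin m → Fin K) w k → classWeight (c ∘ σ) (w ∘ σ) k ≡ classWeight c w k
    classWeight-relabel c w k = sumFin-relabel m σ-inj (λ j → + δ (c j) k * w j)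

    classSize-relabel : ∀ {K} (c : Fin m → Fin K) k → classSize (c ∘ σ) k ≡ classSize c k
    classSize-relabel c k = ℤ.+-injective (begin
      + classSize (c ∘ σ) k                      ≡⟨ classSize-weight (c ∘ σ) k ⟩
      classWeight (c ∘ σ) (λ _ → + 1) k          ≡⟨ classWeight-relabel c (λ _ → + 1) k ⟩
      classWeight c (λ _ → + 1) k                ≡⟨ classSize-weight c k ⟨
      + classSize c k                            ∎)
      where open ≡-Reasoning

    classMatrix-relabel : ∀ {K} α β (c : Fin m → Fin K) w a b →
      classMatrix α β c w (σ a) (σ b) ≡ classMatrix α β (c ∘ σ) (w ∘ σ) a b
    classMatrix-relabel α β c w a b = cong (λ d → + d * α (c (σ a)) + β (c (σ a)) (c (σ b)) * w (σ b)) (δ-injective σ-inj a b)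

  classSize-positive : ∀ {K m} (c : Fin m → Fin K) i → 1 ≤ classSize c (c i)
  classSize-positive c zero    rewrite δ-refl (c zero) = s≤s ℕ.z≤n
  classSize-positive c (suc i) = ℕ.≤-trans (classSize-positive (c ∘ suc) i) (ℕ.m≤n+m _ (δ (c zero) (c (suc i))))

  classSize-witness : ∀ {K m} (c : Fin m → Fin K) k → 1 ≤ classSize c k → ∃ λ i → c i ≡ k
  classSize-witness {m = suc m} c k nonempty with c zero ≟ᶠ k
  ... | yes c₀≡k = zero , c₀≡k
  ... | no  c₀≢k
    with i , cᵢ≡k ← classSize-witness (c ∘ suc) k (subst (1 ≤_) (cong (ℕ._+ classSize (c ∘ suc) k) (δ-≢ c₀≢k)) nonempty)
    = suc i , cᵢ≡k

  injective-onto⇒≡ : ∀ {K m} {c : Fin m → Fin K} → Injective _≡_ _≡_ c → (∀ k → 1 ≤ classSize c k) → m ≡ K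
  injective-onto⇒≡ {c = c} c-inj nonempty = ℕ.≤-antisym (injective⇒≤ c-inj) (injective⇒≤ witness-inj)
    where
    witness-inj : ∀ {k l} → proj₁ (classSize-witness c k (nonempty k)) ≡ proj₁ (classSize-witness c l (nonempty l)) → k ≡ l
    witness-inj {k} {l} e = trans (sym (proj₂ (classSize-witness c k (nonempty k))))
                                  (trans (cong c e) (proj₂ (classSize-witness c l (nonempty l))))

  mergeFirst : ∀ {m} → (Fin (suc (suc m)) → ℤ) → Fin (suc m) → ℤ
  mergeFirst w zero    = w (suc zero) + w zero
  mergeFirst w (suc b) = w (suc (suc b))

  classWeight-merge : ∀ {K m} (k : Fin K) (c : Fin m → Fin K) w l →
    classWeight (k ∷ c) (mergeFirst w) l ≡ classWeight (k ∷ k ∷ c) w l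
  classWeight-merge k c w l = split (+ δ k l) (w (suc zero)) (w zero) _
    where
    split : ∀ d a b s → d * (a + b) + s ≡ d * b + (d * a + s)
    split = solve-∀

  -- After subtracting row 1 from row 0 and adding column 0 to column 1, row 0 is
  -- (α k, 0, …, 0) and the complementary minor is the merged class matrix.
  det-classMatrix-merge : ∀ {K} m (α : Fin K → ℤ) β k (c : Fin m → Fin K) w →
    det (suc (suc m)) (classMatrix α β (k ∷ k ∷ c) w) ≡ α k * det (suc m) (classMatrix α β (k ∷ c) (mergeFirst w))
  det-classMatrix-merge m α β k c w = begin
    det (suc (suc m)) M                                      ≡⟨ det-subtractRow₁ m M ⟨
    det (suc (suc m)) (subtractRow₁ M)                       ≡⟨ det-addColumn₀ m (subtractRow₁ M) ⟨
    det (suc (suc m)) M′                                     ≡⟨ det-row₀-sparse (suc m) M′ row₀ ⟩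
    M′ zero zero * det (suc m) (λ a b → M′ (suc a) (suc b)) ≡⟨ cong₂ _*_ (pivot (α k) _) (det-cong (suc m) merged) ⟩
    α k * det (suc m) (classMatrix α β (k ∷ c) (mergeFirst w)) ∎
    where
    open ≡-Reasoning
    M M′ : Matrix (suc (suc m))
    M = classMatrix α β (k ∷ k ∷ c) w
    M′ = addColumn₀ (subtractRow₁ M)
    pivot : ∀ a x → (+ 1 * a + x) - (+ 0 + x) ≡ a
    pivot = solve-∀
    cancel : ∀ a x y → ((+ 0 + x) - (+ 1 * a + x)) + ((+ 1 * a + y) - (+ 0 + y)) ≡ + 0
    cancel = solve-∀
    row₀ : ∀ j → M′ zero (suc j) ≡ + 0
    row₀ zero    = cancel (α k) (β k k * w (suc zero)) (β k k * w zero)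
    row₀ (suc j) = ℤ.+-inverseʳ (+ 0 + β k (c j) * w (suc (suc j)))
    combine : ∀ d b x y → (d + b * x) + (+ 0 + b * y) ≡ d + b * (x + y)
    combine = solve-∀
    merged : ∀ a b → M′ (suc a) (suc b) ≡ classMatrix α β (k ∷ c) (mergeFirst w) a b
    merged zero    zero    = combine (+ 1 * α k) (β k k) (w (suc zero)) (w zero)
    merged (suc a) zero    = combine (+ 0) (β (c a) k) (w (suc zero)) (w zero)
    merged a       (suc b) = refl

  prodFin : ∀ K → (Fin K → ℤ) → ℤ
  prodFin zero    f = + 1
  prodFin (suc K) f = f zero * prodFin K (f ∘ suc)

  prodFin-cong : ∀ K {f g : Fin K → ℤ} → (∀ k → f k ≡ g k) → prodFin K f ≡ prodFin K g
  prodFin-cong zero    f≗g = refl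
  prodFin-cong (suc K) f≗g = cong₂ _*_ (f≗g zero) (prodFin-cong K (f≗g ∘ suc))

  prodFin-one : ∀ K → prodFin K (λ _ → + 1) ≡ + 1
  prodFin-one zero    = refl
  prodFin-one (suc K) = cong (+ 1 *_) (prodFin-one K)

  prodFin-bump : ∀ K (α : Fin K → ℤ) (e : Fin K → ℕ) k → (∀ l → 1 ≤ e l) →
    α k * prodFin K (λ l → α l ^ (e l ∸ 1)) ≡ prodFin K (λ l → α l ^ (δ k l ℕ.+ e l ∸ 1))
  prodFin-bump (suc K) α e zero positive with e zero | positive zero
  ... | suc e₀ | _ = sym (ℤ.*-assoc (α zero) (α zero ^ e₀) _)
  prodFin-bump (suc K) α e (suc k) positive =
    trans (left-comm (α (suc k)) (α zero ^ (e zero ∸ 1)) _)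
          (cong (λ p → α zero ^ (e zero ∸ 1) * p) (prodFin-bump K (α ∘ suc) (e ∘ suc) k (positive ∘ suc)))
    where
    left-comm : ∀ a b c → a * (b * c) ≡ b * (a * c)
    left-comm = solve-∀

  reducedDet : ∀ {K m} → (Fin K → ℤ) → (Fin K → Fin K → ℤ) → (Fin m → Fin K) → (Fin m → ℤ) → ℤ
  reducedDet {K} α β c w = prodFin K (λ k → α k ^ (classSize c k ∸ 1)) * det K (classMatrix α β id (classWeight c w))

  reducedDet-cong : ∀ {K m m′} α β (c : Fin m → Fin K) w (c′ : Fin m′ → Fin K) w′ →
    (∀ k → classSize c k ≡ classSize c′ k) → (∀ k → classWeight c w k ≡ classWeight c′ w′ k) →
    reducedDet α β c w ≡ reducedDet α β c′ w′
  reducedDet-cong {K} α β c w c′ w′ sizes weights =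
    cong₂ _*_ (prodFin-cong K (λ k → cong (λ e → α k ^ (e ∸ 1)) (sizes k)))
              (det-cong K (classMatrix-cong (λ _ → refl) α β weights))

  module _ {K} (α : Fin K → ℤ) (β : Fin K → Fin K → ℤ) where

    det-classMatrix-relabel : ∀ {m} {σ : Fin m → Fin m} → Injective _≡_ _≡_ σ → ∀ c w →
      det m (classMatrix α β (c ∘ σ) (w ∘ σ)) ≡ reducedDet α β (c ∘ σ) (w ∘ σ) →
      det m (classMatrix α β c w) ≡ reducedDet α β c w
    det-classMatrix-relabel {m} {σ} σ-inj c w reduced = begin
      det m (classMatrix α β c w)                         ≡⟨ det-relabel m σ-inj (classMatrix α β c w) ⟨
      det m (λ a b → classMatrix α β c w (σ a) (σ b))     ≡⟨ det-cong m (classMatrix-relabel σ-inj α β c w) ⟩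
      det m (classMatrix α β (c ∘ σ) (w ∘ σ))             ≡⟨ reduced ⟩
      reducedDet α β (c ∘ σ) (w ∘ σ)
        ≡⟨ reducedDet-cong α β (c ∘ σ) (w ∘ σ) c w (classSize-relabel σ-inj c) (classWeight-relabel σ-inj c w) ⟩
      reducedDet α β c w                                  ∎
      where open ≡-Reasoning

    det-classMatrix-cong : ∀ {m} {c c′ : Fin m → Fin K} → (∀ i → c i ≡ c′ i) → ∀ w →
      det m (classMatrix α β c′ w) ≡ reducedDet α β c′ w → det m (classMatrix α β c w) ≡ reducedDet α β c w
    det-classMatrix-cong {m} {c} {c′} c≗c′ w reduced =
      trans (det-cong m (classMatrix-cong c≗c′ α β (λ _ → refl)))
            (trans reduced (reducedDet-cong α β c′ w c w (λ k → sym (classSize-cong c≗c′ k))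
                                                (λ k → sym (classWeight-cong c≗c′ (λ _ → refl) k))))

    det-classMatrix-split : ∀ {m} k (c : Fin m → Fin K) w → (∀ l → 1 ≤ classSize (k ∷ c) l) →
      det (suc m) (classMatrix α β (k ∷ c) (mergeFirst w)) ≡ reducedDet α β (k ∷ c) (mergeFirst w) →
      det (suc (suc m)) (classMatrix α β (k ∷ k ∷ c) w) ≡ reducedDet α β (k ∷ k ∷ c) w
    det-classMatrix-split {m} k c w nonempty reduced = begin
      det (suc (suc m)) (classMatrix α β (k ∷ k ∷ c) w)          ≡⟨ det-classMatrix-merge m α β k c w ⟩
      α k * det (suc m) (classMatrix α β (k ∷ c) (mergeFirst w)) ≡⟨ cong (α k *_) reduced ⟩
      α k * (prodFin K (λ l → α l ^ (classSize (k ∷ c) l ∸ 1)) * D′) ≡⟨ ℤ.*-assoc (α k) _ D′ ⟨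
      α k * prodFin K (λ l → α l ^ (classSize (k ∷ c) l ∸ 1)) * D′
        ≡⟨ cong₂ _*_ (prodFin-bump K α (classSize (k ∷ c)) k nonempty)
                     (det-cong K (classMatrix-cong (λ _ → refl) α β (classWeight-merge k c w))) ⟩
      reducedDet α β (k ∷ k ∷ c) w                               ∎
      where
      open ≡-Reasoning
      D′ = det K (classMatrix α β id (classWeight (k ∷ c) (mergeFirst w)))

    det-classMatrix-injective : ∀ {m} (c : Fin m → Fin K) w → Injective _≡_ _≡_ c → (∀ k → 1 ≤ classSize c k) →
      det m (classMatrix α β c w) ≡ reducedDet α β c w
    det-classMatrix-injective c w c-inj nonempty with refl ← injective-onto⇒≡ c-inj nonempty = begin
      det K (classMatrix α β c w)                                   ≡⟨ det-cong K entries ⟩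
      det K (λ a b → classMatrix α β id W (c a) (c b))              ≡⟨ det-relabel K c-inj (classMatrix α β id W) ⟩
      det K (classMatrix α β id W)                                  ≡⟨ ℤ.*-identityˡ _ ⟨
      + 1 * det K (classMatrix α β id W)                            ≡⟨ cong (_* det K (classMatrix α β id W)) trivial-product ⟨
      reducedDet α β c w                                            ∎
      where
      open ≡-Reasoning
      W = classWeight c w
      entries : ∀ a b → classMatrix α β c w a b ≡ classMatrix α β id W (c a) (c b)
      entries a b = cong₂ (λ d v → + d * α (c a) + β (c a) (c b) * v)
                          (sym (δ-injective c-inj a b)) (sym (classWeight-injective c-inj w b))
      size-one : ∀ k → classSize c k ≡ 1
      size-one k with i , refl ← classSize-witness c k (nonempty k) =
        ℤ.+-injective (trans (classSize-weight c (c i)) (classWeight-injective c-inj (λ _ → + 1) i))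
      trivial-product : prodFin K (λ k → α k ^ (classSize c k ∸ 1)) ≡ + 1
      trivial-product = trans (prodFin-cong K (λ k → cong (λ e → α k ^ (e ∸ 1)) (size-one k))) (prodFin-one K)

  Collision : ∀ {K m} → (Fin m → Fin K) → Set
  Collision c = ∃ λ i → ∃ λ j → i ≢ j × c i ≡ c j

  collision? : ∀ {K m} (c : Fin m → Fin K) → Dec (Collision c)
  collision? c = any? λ i → any? λ j → ¬? (i ≟ᶠ j) ×-dec (c i ≟ᶠ c j)

  no-collision⇒injective : ∀ {K m} {c : Fin m → Fin K} → ¬ Collision c → Injective _≡_ _≡_ c
  no-collision⇒injective no-collision {a} {b} cₐ≡c_b with a ≟ᶠ b
  ... | yes a≡b = a≡b
  ... | no  a≢b = contradiction (a , b , a≢b , cₐ≡c_b) no-collision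

  classSize-drop-duplicate : ∀ {K m} k (c : Fin m → Fin K) →
    (∀ l → 1 ≤ classSize (k ∷ k ∷ c) l) → ∀ l → 1 ≤ classSize (k ∷ c) l
  classSize-drop-duplicate k c nonempty l with k ≟ᶠ l
  ... | yes refl = classSize-positive (k ∷ c) zero
  ... | no  k≢l  = subst (1 ≤_) (cong (ℕ._+ classSize (k ∷ c) l) (δ-≢ k≢l)) (nonempty l)

  det-classMatrix : ∀ {K} m (α : Fin K → ℤ) β (c : Fin m → Fin K) w → (∀ k → 1 ≤ classSize c k) →
    det m (classMatrix α β c w) ≡ reducedDet α β c w

  -- A colliding pair is moved to positions 0 and 1, where it can be merged.
  det-classMatrix-collision : ∀ {K} m (α : Fin K → ℤ) β (c : Fin m → Fin K) w → (∀ k → 1 ≤ classSize c k) →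
    ∀ i j → i ≢ j → c i ≡ c j → det m (classMatrix α β c w) ≡ reducedDet α β c w

  det-classMatrix m α β c w nonempty with collision? c
  ... | no  none                    = det-classMatrix-injective α β c w (no-collision⇒injective none) nonempty
  ... | yes (i , j , i≢j , cᵢ≡cⱼ) = det-classMatrix-collision m α β c w nonempty i j i≢j cᵢ≡cⱼ

  det-classMatrix-collision (suc zero)    α β c w nonempty zero zero 0≢0 _ = contradiction refl 0≢0
  det-classMatrix-collision {K} (suc (suc m)) α β c w nonempty i j i≢j cᵢ≡cⱼ =
    det-classMatrix-relabel α β (pairToFront-injective i≢j) c w
      (det-classMatrix-cong α β front (w ∘ σ)
        (det-classMatrix-split α β (c i) rest (w ∘ σ) nonempty′
          (det-classMatrix (suc m) α β (c i ∷ rest) (mergeFirst (w ∘ σ)) nonempty′)))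
    where
    σ : Fin (suc (suc m)) → Fin (suc (suc m))
    σ = pairToFront i≢j
    rest : Fin m → Fin K
    rest a = c (σ (suc (suc a)))
    front : ∀ a → c (σ a) ≡ (c i ∷ c i ∷ rest) a
    front zero          = refl
    front (suc zero)    = trans (cong c (pairToFront-one i≢j)) (sym cᵢ≡cⱼ)
    front (suc (suc a)) = refl
    sizes : ∀ l → classSize c l ≡ classSize (c i ∷ c i ∷ rest) l
    sizes l = trans (sym (classSize-relabel (pairToFront-injective i≢j) c l)) (classSize-cong front l)
    nonempty′ : ∀ l → 1 ≤ classSize (c i ∷ rest) l
    nonempty′ = classSize-drop-duplicate (c i) rest (λ l → subst (1 ≤_) (sizes l) (nonempty l))


module PathQuotient where

  open import Defs
  open FinSum
  open Determinant
  open ClassMatrix using (classMatrix)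
  open import Data.Nat.Base using (zero; suc)
  open import Data.Integer.Base using (ℤ; +_; -_; _+_; _*_; _-_)
  import Data.Integer.Properties as ℤ
  open import Data.Integer.Tactic.RingSolver using (solve-∀)
  open import Data.Fin.Base using (Fin; zero; suc)
  open import Data.Fin.Patterns using (0F; 1F; 2F; 3F)
  open import Function.Base using (id)
  open import Relation.Binary.PropositionalEquality

  -- Expanding along row 0 and then (in the transpose) along column 0 of the
  -- second minor gives the continuant recurrence for tridiagonal matrices.
  det-tridiagonal : ∀ m (M : Matrix (suc (suc m))) →
    (∀ j → M zero (suc (suc j)) ≡ + 0) → (∀ i → M (suc (suc i)) zero ≡ + 0) →
    det (suc (suc m)) M ≡ M zero zero * det (suc m) (λ a b → M (suc a) (suc b))
                          - M zero (suc zero) * M (suc zero) zero * det m (λ a b → M (suc (suc a)) (suc (suc b)))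
  det-tridiagonal m M row₀ col₀ = begin
    laplaceTerm M zero + (laplaceTerm M (suc zero) + sumFin m (λ j → laplaceTerm M (suc (suc j))))
      ≡⟨ cong₂ (λ d s → + 1 * (M zero zero * D₁) + ((- + 1) * + 1 * (M zero (suc zero) * d) + s))
               second-minor (sumFin-zero m vanishing) ⟩
    + 1 * (M zero zero * D₁) + ((- + 1) * + 1 * (M zero (suc zero) * (M (suc zero) zero * D₂)) + + 0)
      ≡⟨ simplify (M zero zero) D₁ (M zero (suc zero)) (M (suc zero) zero) D₂ ⟩
    M zero zero * D₁ - M zero (suc zero) * M (suc zero) zero * D₂ ∎
    where
    open ≡-Reasoning
    D₁ = det (suc m) (λ a b → M (suc a) (suc b))
    D₂ = det m (λ a b → M (suc (suc a)) (suc (suc b)))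
    vanishing : ∀ j → laplaceTerm M (suc (suc j)) ≡ + 0
    vanishing j = trans (cong (λ x → sgn (suc (suc j)) * (x * det (suc m) (minor M (suc (suc j))))) (row₀ j))
                        (ℤ.*-zeroʳ (sgn (suc (suc j))))
    second-minor : det (suc m) (minor M (suc zero)) ≡ M (suc zero) zero * D₂
    second-minor = begin
      det (suc m) (minor M (suc zero))
        ≡⟨ det-transpose (suc m) (minor M (suc zero)) ⟨
      det (suc m) (λ a b → minor M (suc zero) b a)
        ≡⟨ det-row₀-sparse m (λ a b → minor M (suc zero) b a) col₀ ⟩
      M (suc zero) zero * det m (λ a b → M (suc (suc b)) (suc (suc a)))
        ≡⟨ cong (M (suc zero) zero *_) (det-transpose m (λ a b → M (suc (suc a)) (suc (suc b)))) ⟩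
      M (suc zero) zero * D₂ ∎
    simplify : ∀ a d₁ b c d₂ → + 1 * (a * d₁) + ((- + 1) * + 1 * (b * (c * d₂)) + + 0) ≡ a * d₁ - b * c * d₂
    simplify = solve-∀

  pathAdj : Fin 4 → Fin 4 → ℤ
  pathAdj 0F 1F = + 1
  pathAdj 1F 0F = + 1
  pathAdj 1F 2F = + 1
  pathAdj 2F 1F = + 1
  pathAdj 2F 3F = + 1
  pathAdj 3F 2F = + 1
  pathAdj _  _  = + 0

  pathContinuant : (Fin 4 → ℤ) → (Fin 4 → ℤ) → ℤ
  pathContinuant α s = α 0F * (α 1F * (α 2F * α 3F - s 3F * s 2F) - s 2F * s 1F * α 3F)
                     - s 1F * s 0F * (α 2F * α 3F - s 3F * s 2F)

  det-pathClassMatrix : ∀ (α s : Fin 4 → ℤ) → det 4 (classMatrix α pathAdj id s) ≡ pathContinuant α s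
  det-pathClassMatrix α s = begin
    det 4 M
      ≡⟨ det-tridiagonal 2 M (λ { 0F → refl ; 1F → refl }) (λ { 0F → refl ; 1F → refl }) ⟩
    M 0F 0F * det 3 (λ a b → M (suc a) (suc b)) - M 0F 1F * M 1F 0F * det 2 M₂
      ≡⟨ cong₂ (λ d₃ d₂ → M 0F 0F * d₃ - M 0F 1F * M 1F 0F * d₂)
               (trans (det-tridiagonal 1 (λ a b → M (suc a) (suc b)) (λ { 0F → refl }) (λ { 0F → refl }))
                      (cong (λ d₂ → M 1F 1F * d₂ - M 1F 2F * M 2F 1F * det 1 (λ a b → M 3F 3F)) det₂))
               det₂ ⟩
    M 0F 0F * (M 1F 1F * (M 2F 2F * det 1 M₃ - M 2F 3F * M 3F 2F * + 1) - M 1F 2F * M 2F 1F * det 1 M₃)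
      - M 0F 1F * M 1F 0F * (M 2F 2F * det 1 M₃ - M 2F 3F * M 3F 2F * + 1)
      ≡⟨ collect (α 0F) (α 1F) (α 2F) (α 3F) (s 0F) (s 1F) (s 2F) (s 3F) ⟩
    pathContinuant α s ∎
    where
    open ≡-Reasoning
    M = classMatrix α pathAdj id s
    M₂ M₃ : Matrix _
    M₂ a b = M (suc (suc a)) (suc (suc b))
    M₃ a b = M 3F 3F
    det₂ : det 2 M₂ ≡ M 2F 2F * det 1 M₃ - M 2F 3F * M 3F 2F * + 1
    det₂ = det-tridiagonal 0 M₂ (λ ()) (λ ())
    collect : ∀ a₀ a₁ a₂ a₃ s₀ s₁ s₂ s₃ →
      let d a s = + 1 * a + + 0 * s
          o a s = + 0 * a + + 1 * s
          d₃ = + 1 * (d a₃ s₃ * + 1) + + 0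
      in d a₀ s₀ * (d a₁ s₁ * (d a₂ s₂ * d₃ - o a₂ s₃ * o a₃ s₂ * + 1) - o a₁ s₂ * o a₂ s₁ * d₃)
         - o a₀ s₁ * o a₁ s₀ * (d a₂ s₂ * d₃ - o a₂ s₃ * o a₃ s₂ * + 1)
       ≡ a₀ * (a₁ * (a₂ * a₃ - s₃ * s₂) - s₂ * s₁ * a₃) - s₁ * s₀ * (a₂ * a₃ - s₃ * s₂)
    collect = solve-∀

  neighbourSum : (Fin 4 → ℤ) → Fin 4 → ℤ
  neighbourSum s 0F = s 1F
  neighbourSum s 1F = s 0F + s 2F
  neighbourSum s 2F = s 1F + s 3F
  neighbourSum s 3F = s 2F

  pathDegree : ∀ (s : Fin 4 → ℤ) k → sumFin 4 (λ l → pathAdj k l * s l) ≡ neighbourSum s k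
  pathDegree s 0F = end  (s 0F) (s 1F) (s 2F) (s 3F)
    where
    end : ∀ a b c d → + 0 * a + (+ 1 * b + (+ 0 * c + (+ 0 * d + + 0))) ≡ b
    end = solve-∀
  pathDegree s 1F = inner (s 0F) (s 1F) (s 2F) (s 3F)
    where
    inner : ∀ a b c d → + 1 * a + (+ 0 * b + (+ 1 * c + (+ 0 * d + + 0))) ≡ a + c
    inner = solve-∀
  pathDegree s 2F = inner (s 0F) (s 1F) (s 2F) (s 3F)
    where
    inner : ∀ a b c d → + 0 * a + (+ 1 * b + (+ 0 * c + (+ 1 * d + + 0))) ≡ b + d
    inner = solve-∀
  pathDegree s 3F = end (s 0F) (s 1F) (s 2F) (s 3F)
    where
    end : ∀ a b c d → + 0 * a + (+ 0 * b + (+ 1 * c + (+ 0 * d + + 0))) ≡ c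
    end = solve-∀


module Arithmetic where

  open import Data.Nat.Base using (ℕ; suc; _+_; _*_; _%_; _/_; NonZero)
  import Data.Nat.Properties as ℕ
  import Data.Nat.Tactic.RingSolver as ℕ-Ring
  open import Data.Nat.Divisibility
  open import Data.Nat.DivMod using (m%n<n; [m+kn]%n≡m%n; %-distribˡ-*; m%n%n≡m%n; m≡m%n+[m/n]*n)
  open import Data.Nat.GCD using (gcd; gcd-GCD; gcd[m,n]∣m; gcd[m,n]∣n; c*gcd[m,n]≡gcd[cm,cn]; module Bézout)
  open import Data.Nat.Coprimality using (Coprime; coprime-divisor; coprime⇒gcd≡1)
  import Data.Nat.Coprimality as Coprime
  open import Data.Nat.Primality using (Prime; prime⇒irreducible; prime⇒nonTrivial)
  open import Data.Fin.Base using (Fin; toℕ; fromℕ<)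
  open import Data.Fin.Properties using (toℕ-fromℕ<)
  open import Data.Product.Base using (∃; _,_)
  open import Data.Sum.Base using (inj₁; inj₂)
  open import Relation.Nullary using (¬_)
  open import Relation.Nullary.Negation using (contradiction)
  open import Relation.Binary.PropositionalEquality

  prime-coprime : ∀ {r} a → Prime r → ¬ r ∣ a → Coprime a r
  prime-coprime a r-prime r∤a (d∣a , d∣r) with prime⇒irreducible r-prime d∣r
  ... | inj₁ d≡1   = d≡1
  ... | inj₂ refl  = contradiction d∣a r∤a

  coprime-* : ∀ {a b c} → Coprime a b → Coprime a c → Coprime a (b * c)
  coprime-* a⊥b a⊥c (d∣a , d∣bc) = a⊥c (d∣a , coprime-divisor d⊥b d∣bc)
    where
    d⊥b : Coprime _ _
    d⊥b (e∣d , e∣b) = a⊥b (∣-trans e∣d d∣a , e∣b)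

  coprime⇒*∣ : ∀ {a b x} → Coprime a b → a ∣ x → b ∣ x → a * b ∣ x
  coprime⇒*∣ {a} {b} a⊥b (divides k refl) b∣ka with coprime-divisor (Coprime.sym a⊥b) (subst (b ∣_) (ℕ.*-comm k a) b∣ka)
  ... | divides l refl = divides l (trans (ℕ.*-assoc l b a) (cong (l *_) (ℕ.*-comm b a)))

  gcd-cofactor : ∀ {a n d a′ n′} → a ≡ d * a′ → n ≡ d * n′ → Coprime a′ n′ → gcd a n ≡ d
  gcd-cofactor {d = d} {a′} {n′} refl refl a′⊥n′ = begin
    gcd (d * a′) (d * n′) ≡⟨ c*gcd[m,n]≡gcd[cm,cn] d a′ n′ ⟨
    d * gcd a′ n′         ≡⟨ cong (d *_) (coprime⇒gcd≡1 a′⊥n′) ⟩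
    d * 1                 ≡⟨ ℕ.*-identityʳ d ⟩
    d                     ∎
    where open ≡-Reasoning

  distinct-primes-∤ : ∀ {r s} → Prime r → Prime s → r ≢ s → ¬ r ∣ s
  distinct-primes-∤ r-prime s-prime r≢s r∣s with prime⇒irreducible s-prime r∣s
  ... | inj₁ refl = contradiction (prime⇒nonTrivial r-prime) (λ ())
  ... | inj₂ r≡s  = r≢s r≡s

  ∣-cofactor : ∀ {a a′ d e} → a ≡ a′ * d → e ∣ a′ → e ∣ a
  ∣-cofactor {d = d} refl e∣a′ = ∣m⇒∣m*n d e∣a′

  -- Bézout modulo n. When the identity comes as g + u·y = v·n, the witness is
  -- (n - 1)·u, because (n - 1)·u·y ≡ -u·y ≡ g.
  gcd-residue : ∀ y n .{{_ : NonZero n}} → ∃ λ u → (u * y) % n ≡ gcd y n % n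
  gcd-residue y n with Bézout.identity {y} {n} (gcd-GCD y n)
  ... | Bézout.+- u v g+vn≡uy = u , (begin
    (u * y) % n            ≡⟨ cong (_% n) g+vn≡uy ⟨
    (gcd y n + v * n) % n  ≡⟨ [m+kn]%n≡m%n (gcd y n) v n ⟩
    gcd y n % n            ∎)
    where open ≡-Reasoning
  gcd-residue y n@(suc n′) | Bézout.-+ u v g+uy≡vn = n′ * u , (begin
    (n′ * u * y) % n                          ≡⟨ [m+kn]%n≡m%n (n′ * u * y) v n ⟨
    (n′ * u * y + v * n) % n                  ≡⟨ cong (λ t → (n′ * u * y + t) % n) g+uy≡vn ⟨
    (n′ * u * y + (gcd y n + u * y)) % n      ≡⟨ cong (_% n) (regroup n′ u y (gcd y n)) ⟩
    (gcd y n + (u * y) * n) % n               ≡⟨ [m+kn]%n≡m%n (gcd y n) (u * y) n ⟩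
    gcd y n % n                               ∎)
    where
    open ≡-Reasoning
    regroup : ∀ n′ u y g → n′ * u * y + (g + u * y) ≡ g + u * y * suc n′
    regroup = ℕ-Ring.solve-∀

  module _ {n : ℕ} .{{_ : NonZero n}} where

    %-absorbˡ : ∀ a b → ((a % n) * b) % n ≡ (a * b) % n
    %-absorbˡ a b = begin
      ((a % n) * b) % n         ≡⟨ %-distribˡ-* (a % n) b n ⟩
      (a % n % n * (b % n)) % n ≡⟨ cong (λ x → (x * (b % n)) % n) (m%n%n≡m%n a n) ⟩
      (a % n * (b % n)) % n     ≡⟨ %-distribˡ-* a b n ⟨
      (a * b) % n               ∎
      where open ≡-Reasoning

    %-absorbʳ : ∀ a b → (a * (b % n)) % n ≡ (a * b) % n
    %-absorbʳ a b = begin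
      (a * (b % n)) % n ≡⟨ cong (_% n) (ℕ.*-comm a (b % n)) ⟩
      ((b % n) * a) % n ≡⟨ %-absorbˡ b a ⟩
      (b * a) % n       ≡⟨ cong (_% n) (ℕ.*-comm b a) ⟩
      (a * b) % n       ∎
      where open ≡-Reasoning

    gcd∣⇒residue : ∀ {y z} → gcd y n ∣ z → ∃ λ (r : Fin n) → (toℕ r * y) % n ≡ z % n
    gcd∣⇒residue {y} (divides k refl) with u , uy≡g ← gcd-residue y n =
      fromℕ< (m%n<n (k * u) n) , (begin
      (toℕ (fromℕ< (m%n<n (k * u) n)) * y) % n ≡⟨ cong (λ t → (t * y) % n) (toℕ-fromℕ< (m%n<n (k * u) n)) ⟩
      ((k * u) % n * y) % n                     ≡⟨ %-absorbˡ (k * u) y ⟩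
      (k * u * y) % n                           ≡⟨ cong (_% n) (ℕ.*-assoc k u y) ⟩
      (k * (u * y)) % n                         ≡⟨ %-absorbʳ k (u * y) ⟨
      (k * ((u * y) % n)) % n                   ≡⟨ cong (λ t → (k * t) % n) uy≡g ⟩
      (k * (gcd y n % n)) % n                   ≡⟨ %-absorbʳ k (gcd y n) ⟩
      (k * gcd y n) % n                         ∎)
      where open ≡-Reasoning

    residue⇒gcd∣ : ∀ {y z} r → (r * y) % n ≡ z % n → gcd y n ∣ z
    residue⇒gcd∣ {y} {z} r ry≡z = subst (gcd y n ∣_) (sym (m≡m%n+[m/n]*n z n))
      (∣m∣n⇒∣m+n (subst (gcd y n ∣_) ry≡z (%-presˡ-∣ (∣n⇒∣m*n r (gcd[m,n]∣m y n)) (gcd[m,n]∣n y n)))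
                 (∣n⇒∣m*n (z / n) (gcd[m,n]∣n y n)))


module CozeroDivisorGraph where

  open import Defs
  open Arithmetic using (gcd∣⇒residue; residue⇒gcd∣)
  open import Data.Nat.Base using (ℕ; suc; _%_; NonZero)
  open import Data.Nat.Divisibility
  open import Data.Nat.DivMod using (m<n⇒m%n≡m)
  open import Data.Nat.GCD using (gcd; gcd[m,n]∣m; gcd[m,n]∣n; gcd-greatest)
  open import Data.Integer.Base using (ℤ; +_)
  open import Data.Fin.Base using (Fin; toℕ)
  open import Data.Fin.Properties using (toℕ<n) renaming (_≟_ to _≟ᶠ_)
  open import Data.Product.Base using (_,_)
  open import Data.Sum.Base using (_⊎_; inj₁; inj₂)
  open import Function.Base using (_∘_)
  open import Function.Bundles using (_⇔_; mk⇔; Equivalence)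
  open import Relation.Nullary using (yes; no; ¬_; _⊎-dec_)
  open import Relation.Nullary.Negation using (contradiction)
  open import Relation.Binary.PropositionalEquality

  modN≡% : ∀ n .{{_ : NonZero n}} a → modN n a ≡ a % n
  modN≡% (suc n) a = refl

  module _ {n : ℕ} .{{_ : NonZero n}} where

    inIdeal⇔gcd∣ : (x y : Fin n) → InIdeal n x y ⇔ gcd (toℕ y) n ∣ toℕ x
    inIdeal⇔gcd∣ x y = mk⇔
      (λ { (r , ry≡x) → residue⇒gcd∣ {n} {toℕ y} (toℕ r) (trans (sym (modN≡% n _)) (trans ry≡x (sym x%n≡x))) })
      (λ g∣x → let r , ry≡x = gcd∣⇒residue {n} {toℕ y} g∣x in r , trans (modN≡% n _) (trans ry≡x x%n≡x))
      where
      x%n≡x : toℕ x % n ≡ toℕ x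
      x%n≡x = m<n⇒m%n≡m (toℕ<n x)

    isUnit⇔gcd∣1 : (x : Fin n) → IsUnit n x ⇔ gcd (toℕ x) n ∣ 1
    isUnit⇔gcd∣1 x = mk⇔
      (λ { (r , rx≡1) → residue⇒gcd∣ {n} {toℕ x} (toℕ r) (trans (sym (modN≡% n _)) (trans rx≡1 (modN≡% n 1))) })
      (λ g∣1 → let r , rx≡1 = gcd∣⇒residue {n} {toℕ x} g∣1 in r , trans (modN≡% n _) (trans rx≡1 (sym (modN≡% n 1))))

    -- Since gcd y n divides n, it divides x iff it divides gcd x n.
    inIdeal⇔gcd∣gcd : (x y : Fin n) → InIdeal n x y ⇔ gcd (toℕ y) n ∣ gcd (toℕ x) n
    inIdeal⇔gcd∣gcd x y = mk⇔
      (λ x∈Ry → gcd-greatest (Equivalence.to (inIdeal⇔gcd∣ x y) x∈Ry) (gcd[m,n]∣n (toℕ y) n))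
      (λ g∣g → Equivalence.from (inIdeal⇔gcd∣ x y) (∣-trans g∣g (gcd[m,n]∣m (toℕ x) n)))

  incomparable : ℕ → ℕ → ℤ
  incomparable a b with a ∣? b ⊎-dec b ∣? a
  ... | yes _ = + 0
  ... | no  _ = + 1

  incomparable-comparable : ∀ {a b} → a ∣ b ⊎ b ∣ a → incomparable a b ≡ + 0
  incomparable-comparable {a} {b} comparable with a ∣? b ⊎-dec b ∣? a
  ... | yes _ = refl
  ... | no  incomparable = contradiction comparable incomparable

  incomparable-incomparable : ∀ {a b} → ¬ a ∣ b → ¬ b ∣ a → incomparable a b ≡ + 1
  incomparable-incomparable {a} {b} a∤b b∤a with a ∣? b ⊎-dec b ∣? a
  ... | yes (inj₁ a∣b) = contradiction a∣b a∤b
  ... | yes (inj₂ b∣a) = contradiction b∣a b∤a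
  ... | no  _          = refl

  module _ (n : ℕ) .{{_ : NonZero n}} where

    vertexGcd : Fin (numVertices n) → ℕ
    vertexGcd i = gcd (toℕ (vertex n i)) n

    adjMatrix≡incomparable : ∀ i j → adjMatrix n i j ≡ incomparable (vertexGcd i) (vertexGcd j)
    adjMatrix≡incomparable i j with Adjacent? n i j
    ... | yes (_ , xᵢ∉Rxⱼ , xⱼ∉Rxᵢ) = sym (incomparable-incomparable
            (xⱼ∉Rxᵢ ∘ Equivalence.from (inIdeal⇔gcd∣gcd (vertex n j) (vertex n i)))
            (xᵢ∉Rxⱼ ∘ Equivalence.from (inIdeal⇔gcd∣gcd (vertex n i) (vertex n j))))
    ... | no not-adjacent = sym (incomparable-comparable comparable)
      where
      comparable : vertexGcd i ∣ vertexGcd j ⊎ vertexGcd j ∣ vertexGcd i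
      comparable with i ≟ᶠ j | vertexGcd i ∣? vertexGcd j | vertexGcd j ∣? vertexGcd i
      ... | yes refl | _ | _ = inj₁ ∣-refl
      ... | no _ | yes gᵢ∣gⱼ | _ = inj₁ gᵢ∣gⱼ
      ... | no _ | no _ | yes gⱼ∣gᵢ = inj₂ gⱼ∣gᵢ
      ... | no i≢j | no gᵢ∤gⱼ | no gⱼ∤gᵢ = contradiction
        (i≢j , gⱼ∤gᵢ ∘ Equivalence.to (inIdeal⇔gcd∣gcd (vertex n i) (vertex n j))
             , gᵢ∤gⱼ ∘ Equivalence.to (inIdeal⇔gcd∣gcd (vertex n j) (vertex n i)))
        not-adjacent


module Counting where

  open import Defs
  open FinSum using (sumFin-cong; sumFin-zero; sumFin-+; sumFin-neg)
  open import Data.Nat.Base as ℕ using (ℕ; zero; suc; NonZero)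
  import Data.Nat.Properties as ℕ
  open import Data.Nat.Divisibility using (_∣?_; _∣0; ∣⇒≤; ∣m+n∣m⇒∣n; ∣m∣n⇒∣m+n; ∣-refl)
  open import Data.Integer.Base using (ℤ; +_; -_; _+_; _*_; _-_)
  import Data.Integer.Properties as ℤ
  open import Data.Fin.Base using (Fin; zero; suc; toℕ; _↑ˡ_; _↑ʳ_)
  open import Data.Fin.Properties using (toℕ-↑ˡ; toℕ-↑ʳ; toℕ<n)
  open import Data.List.Base using (filter; length; lookup; tabulate)
  open import Function.Base using (_∘_)
  open import Relation.Nullary using (Dec; yes; no; ¬_)
  open import Relation.Nullary.Negation using (contradiction)
  open import Relation.Unary using (Pred; Decidable)
  open import Relation.Binary.PropositionalEquality

  𝟙 : ∀ {A : Set} → Dec A → ℤ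
  𝟙 (yes _) = + 1
  𝟙 (no  _) = + 0

  𝟙-yes : ∀ {A : Set} (a? : Dec A) → A → 𝟙 a? ≡ + 1
  𝟙-yes (yes _) _ = refl
  𝟙-yes (no ¬a) a = contradiction a ¬a

  𝟙-no : ∀ {A : Set} (a? : Dec A) → ¬ A → 𝟙 a? ≡ + 0
  𝟙-no (yes a) ¬a = contradiction a ¬a
  𝟙-no (no  _) _  = refl

  sumFin-- : ∀ m (f g : Fin m → ℤ) → sumFin m (λ i → f i - g i) ≡ sumFin m f - sumFin m g
  sumFin-- m f g = trans (sumFin-+ m f (λ i → - g i)) (cong (λ s → sumFin m f + s) (sumFin-neg m g))

  sumFin-↑ : ∀ a b (f : Fin (a ℕ.+ b) → ℤ) → sumFin (a ℕ.+ b) f ≡ sumFin a (f ∘ (_↑ˡ b)) + sumFin b (f ∘ (a ↑ʳ_))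
  sumFin-↑ zero    b f = sym (ℤ.+-identityˡ _)
  sumFin-↑ (suc a) b f = trans (cong (λ s → f zero + s) (sumFin-↑ a b (f ∘ suc))) (sym (ℤ.+-assoc (f zero) _ _))

  sumFin-filter : ∀ {A : Set} {P : Pred A _} (P? : Decidable P) (h : A → ℤ) {n} (f : Fin n → A) →
    let ys = filter P? (tabulate f) in
    sumFin (length ys) (h ∘ lookup ys) ≡ sumFin n (λ i → 𝟙 (P? (f i)) * h (f i))
  sumFin-filter P? h {zero}  f = refl
  sumFin-filter P? h {suc n} f with P? (f zero)
  ... | yes _ = cong₂ _+_ (sym (ℤ.*-identityˡ (h (f zero)))) (sumFin-filter P? h (f ∘ suc))
  ... | no  _ = trans (sumFin-filter P? h (f ∘ suc)) (sym (ℤ.+-identityˡ _))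

  count-multiples-block : ∀ d .{{_ : NonZero d}} → sumFin d (λ x → 𝟙 (d ∣? toℕ x)) ≡ + 1
  count-multiples-block (suc d) = cong₂ _+_ (𝟙-yes (suc d ∣? 0) (suc d ∣0))
    (sumFin-zero d λ y → 𝟙-no (suc d ∣? suc (toℕ y)) (λ d∣y → ℕ.<⇒≱ (toℕ<n (suc y)) (∣⇒≤ d∣y)))

  -- Each block of d consecutive residues contains exactly one multiple of d.
  count-multiples : ∀ d t .{{_ : NonZero d}} → sumFin (t ℕ.* d) (λ x → 𝟙 (d ∣? toℕ x)) ≡ + t
  count-multiples d zero    = refl
  count-multiples d (suc t) = begin
    sumFin (d ℕ.+ t ℕ.* d) (λ x → 𝟙 (d ∣? toℕ x))
      ≡⟨ sumFin-↑ d (t ℕ.* d) _ ⟩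
    sumFin d (λ x → 𝟙 (d ∣? toℕ (x ↑ˡ t ℕ.* d))) + sumFin (t ℕ.* d) (λ x → 𝟙 (d ∣? toℕ (d ↑ʳ x)))
      ≡⟨ cong₂ _+_ (trans (sumFin-cong d (λ x → cong (λ a → 𝟙 (d ∣? a)) (toℕ-↑ˡ x _))) (count-multiples-block d))
                   (trans (sumFin-cong (t ℕ.* d) (λ x → shift (toℕ x) (toℕ-↑ʳ d x))) (count-multiples d t)) ⟩
    + 1 + + t ∎
    where
    open ≡-Reasoning
    shift : ∀ a {b} → b ≡ d ℕ.+ a → 𝟙 (d ∣? b) ≡ 𝟙 (d ∣? a)
    shift a refl with d ∣? (d ℕ.+ a) | d ∣? a
    ... | yes _     | yes _   = refl
    ... | no  _     | no  _   = refl
    ... | yes d∣d+a | no  d∤a = contradiction (∣m+n∣m⇒∣n d∣d+a ∣-refl) d∤a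
    ... | no  d∤d+a | yes d∣a = contradiction (∣m∣n⇒∣m+n ∣-refl d∣a) d∤d+a


module PrimeSquareTimesPrime (p q : ℕ) (p-prime : Prime p) (q-prime : Prime q) (p≢q : p ≢ q) where

  open import Defs
  open FinSum using (sumFin-cong; δ; δ-refl; δ-≢)
  open Determinant using (det-cong)
  open ClassMatrix
    using (classMatrix; classMatrix-cong; classSize; classWeight; classSize-weight; sumFin-byClass;
           prodFin; prodFin-cong; reducedDet; det-classMatrix)
  open Arithmetic
  open CozeroDivisorGraph
  open Counting
  open PathQuotient using (pathAdj; neighbourSum; pathDegree; pathContinuant; det-pathClassMatrix)
  open import Data.Nat.Base as ℕ using (zero; suc; _∸_; _<_; _≤_; NonZero)
  import Data.Nat.Properties as ℕ
  open import Data.Nat.Divisibility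
  open import Data.Nat.Coprimality using (Coprime; coprime⇒gcd≡1)
  import Data.Nat.Coprimality as Coprime
  open import Data.Nat.GCD using (gcd; gcd-greatest)
  open import Data.Nat.Primality using (prime⇒nonZero; prime⇒nonTrivial; euclidsLemma)
  open import Data.Integer.Base using (ℤ; +_; -_; _+_; _-_; _*_; _^_)
  open import Data.Integer.Tactic.RingSolver using (solve-∀)
  import Data.Integer.Properties as ℤ
  open import Data.Fin.Base using (Fin; zero; suc; toℕ)
  open import Data.Fin.Properties using (toℕ<n) renaming (_≟_ to _≟ᶠ_)
  open import Data.List.Base using (allFin)
  import Data.List.Relation.Unary.All as All
  open import Data.List.Relation.Unary.All.Properties using (all-filter)
  open import Data.List.Membership.Propositional.Properties using (∈-lookup)
  open import Data.Product.Base using (_×_; _,_; proj₁)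
  open import Data.Sum.Base using (_⊎_; inj₁; inj₂)
  open import Function.Base using (_∘_; id)
  open import Function.Bundles using (Equivalence)
  open import Relation.Nullary using (yes; no; ¬_)
  open import Relation.Nullary.Negation using (contradiction)
  open import Relation.Binary.PropositionalEquality

  pattern 𝐩  = zero
  pattern 𝐪  = suc zero
  pattern 𝐩² = suc (suc zero)
  pattern 𝐩𝐪 = suc (suc (suc zero))

  instance
    p-nonZero : NonZero p
    p-nonZero = prime⇒nonZero p-prime
    q-nonZero : NonZero q
    q-nonZero = prime⇒nonZero q-prime
    pp-nonZero : NonZero (p ℕ.* p)
    pp-nonZero = ℕ.m*n≢0 p p
    pq-nonZero : NonZero (p ℕ.* q)
    pq-nonZero = ℕ.m*n≢0 p q

  n : ℕ
  n = p ℕ.* p ℕ.* q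

  instance
    n-nonZero : NonZero n
    n-nonZero = ℕ.m*n≢0 (p ℕ.* p) q

  1<p : 1 < p
  1<p = ℕ.nonTrivial⇒n>1 p {{prime⇒nonTrivial p-prime}}

  1<q : 1 < q
  1<q = ℕ.nonTrivial⇒n>1 q {{prime⇒nonTrivial q-prime}}

  p∤q : ¬ p ∣ q
  p∤q = distinct-primes-∤ p-prime q-prime p≢q

  q∤p : ¬ q ∣ p
  q∤p = distinct-primes-∤ q-prime p-prime (p≢q ∘ sym)

  p⊥q : Coprime p q
  p⊥q = prime-coprime p q-prime q∤p

  q∤p*p : ¬ q ∣ p ℕ.* p
  q∤p*p q∣pp with euclidsLemma p p q-prime q∣pp
  ... | inj₁ q∣p = q∤p q∣p
  ... | inj₂ q∣p = q∤p q∣p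

  p*p∤q : ¬ p ℕ.* p ∣ q
  p*p∤q = p∤q ∘ m*n∣⇒m∣ p p

  p*p∤p*q : ¬ p ℕ.* p ∣ p ℕ.* q
  p*p∤p*q = p∤q ∘ *-cancelˡ-∣ p

  p*q∤p*p : ¬ p ℕ.* q ∣ p ℕ.* p
  p*q∤p*p = q∤p ∘ *-cancelˡ-∣ p

  classOf : ℕ → Fin 4
  classOf a with q ∣? a | p ∣? a | p ℕ.* p ∣? a
  ... | yes _ | yes _ | _     = 𝐩𝐪
  ... | yes _ | no  _ | _     = 𝐪
  ... | no  _ | _     | yes _ = 𝐩²
  ... | no  _ | _     | no  _ = 𝐩

  divisorOf : Fin 4 → ℕ
  divisorOf 𝐩  = p
  divisorOf 𝐪  = q
  divisorOf 𝐩² = p ℕ.* p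
  divisorOf 𝐩𝐪 = p ℕ.* q

  gcd≡divisorOf : ∀ a → a ≢ 0 → a < n → p ∣ a ⊎ q ∣ a → gcd a n ≡ divisorOf (classOf a)
  gcd≡divisorOf a a≢0 a<n p∣a⊎q∣a with q ∣? a | p ∣? a | p ℕ.* p ∣? a
  ... | yes q∣a | yes p∣a | _ with divides a′ a≡a′pq ← coprime⇒*∣ p⊥q p∣a q∣a =
    gcd-cofactor (trans a≡a′pq (ℕ.*-comm a′ (p ℕ.* q))) n≡pq*p (prime-coprime a′ p-prime p∤a′)
    where
    n≡pq*p : n ≡ p ℕ.* q ℕ.* p
    n≡pq*p = trans (ℕ.*-assoc p p q) (ℕ.*-comm p (p ℕ.* q))
    p∤a′ : ¬ p ∣ a′
    p∤a′ p∣a′ = ℕ.<⇒≱ a<n (∣⇒≤ {{ℕ.≢-nonZero a≢0}} n∣a)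
      where
      n∣a : n ∣ a
      n∣a = subst₂ _∣_ (sym (ℕ.*-assoc p p q)) (sym a≡a′pq) (*-monoˡ-∣ (p ℕ.* q) p∣a′)
  ... | yes q∣a | no  p∤a | _ with divides a′ a≡a′q ← q∣a =
    gcd-cofactor (trans a≡a′q (ℕ.*-comm a′ q)) (ℕ.*-comm (p ℕ.* p) q)
      (coprime-* (prime-coprime a′ p-prime p∤a′) (prime-coprime a′ p-prime p∤a′))
    where
    p∤a′ : ¬ p ∣ a′
    p∤a′ = p∤a ∘ ∣-cofactor a≡a′q
  ... | no  q∤a | _ | yes p²∣a with divides a′ a≡a′p² ← p²∣a =
    gcd-cofactor (trans a≡a′p² (ℕ.*-comm a′ (p ℕ.* p))) refl (prime-coprime a′ q-prime (q∤a ∘ ∣-cofactor a≡a′p²))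
  ... | no  q∤a | _ | no  p²∤a with p∣a⊎q∣a
  ...   | inj₂ q∣a = contradiction q∣a q∤a
  ...   | inj₁ (divides a′ a≡a′p) =
    gcd-cofactor (trans a≡a′p (ℕ.*-comm a′ p)) (ℕ.*-assoc p p q)
      (coprime-* (prime-coprime a′ p-prime p∤a′) (prime-coprime a′ q-prime (q∤a ∘ ∣-cofactor a≡a′p)))
    where
    p∤a′ : ¬ p ∣ a′
    p∤a′ p∣a′ = p²∤a (subst (p ℕ.* p ∣_) (sym a≡a′p) (*-monoˡ-∣ p p∣a′))

  vertex-isVertex : ∀ i → IsVertex n (vertex n i)
  vertex-isVertex i = All.lookup (all-filter (IsVertex? n) (allFin n)) (∈-lookup i)

  vertex-divisor : ∀ (x : Fin n) → IsVertex n x → p ∣ toℕ x ⊎ q ∣ toℕ x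
  vertex-divisor x (_ , non-unit) with p ∣? toℕ x | q ∣? toℕ x
  ... | yes p∣x | _       = inj₁ p∣x
  ... | no  _   | yes q∣x = inj₂ q∣x
  ... | no  p∤x | no  q∤x = contradiction (Equivalence.from (isUnit⇔gcd∣1 x) (∣-reflexive (coprime⇒gcd≡1 x⊥n))) non-unit
    where
    x⊥n : Coprime (toℕ x) n
    x⊥n = coprime-* (coprime-* (prime-coprime _ p-prime p∤x) (prime-coprime _ p-prime p∤x)) (prime-coprime _ q-prime q∤x)

  vertexClass : Fin (numVertices n) → Fin 4
  vertexClass i = classOf (toℕ (vertex n i))

  vertexGcd≡divisorOf : ∀ i → vertexGcd n i ≡ divisorOf (vertexClass i)
  vertexGcd≡divisorOf i = gcd≡divisorOf (toℕ x) (proj₁ (vertex-isVertex i)) (toℕ<n x) (vertex-divisor x (vertex-isVertex i))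
    where x = vertex n i

  divisorOf-incomparable : ∀ k l → incomparable (divisorOf k) (divisorOf l) ≡ pathAdj k l
  divisorOf-incomparable 𝐩  𝐩  = incomparable-comparable (inj₁ ∣-refl)
  divisorOf-incomparable 𝐩  𝐪  = incomparable-incomparable p∤q q∤p
  divisorOf-incomparable 𝐩  𝐩² = incomparable-comparable (inj₁ (m∣m*n p))
  divisorOf-incomparable 𝐩  𝐩𝐪 = incomparable-comparable (inj₁ (m∣m*n q))
  divisorOf-incomparable 𝐪  𝐩  = incomparable-incomparable q∤p p∤q
  divisorOf-incomparable 𝐪  𝐪  = incomparable-comparable (inj₁ ∣-refl)
  divisorOf-incomparable 𝐪  𝐩² = incomparable-incomparable q∤p*p p*p∤q
  divisorOf-incomparable 𝐪  𝐩𝐪 = incomparable-comparable (inj₁ (n∣m*n p))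
  divisorOf-incomparable 𝐩² 𝐩  = incomparable-comparable (inj₂ (m∣m*n p))
  divisorOf-incomparable 𝐩² 𝐪  = incomparable-incomparable p*p∤q q∤p*p
  divisorOf-incomparable 𝐩² 𝐩² = incomparable-comparable (inj₁ ∣-refl)
  divisorOf-incomparable 𝐩² 𝐩𝐪 = incomparable-incomparable p*p∤p*q p*q∤p*p
  divisorOf-incomparable 𝐩𝐪 𝐩  = incomparable-comparable (inj₂ (m∣m*n q))
  divisorOf-incomparable 𝐩𝐪 𝐪  = incomparable-comparable (inj₂ (n∣m*n p))
  divisorOf-incomparable 𝐩𝐪 𝐩² = incomparable-incomparable p*q∤p*p p*p∤p*q
  divisorOf-incomparable 𝐩𝐪 𝐩𝐪 = incomparable-comparable (inj₁ ∣-refl)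

  adjMatrix≡pathAdj : ∀ i j → adjMatrix n i j ≡ pathAdj (vertexClass i) (vertexClass j)
  adjMatrix≡pathAdj i j = begin
    adjMatrix n i j
      ≡⟨ adjMatrix≡incomparable n i j ⟩
    incomparable (vertexGcd n i) (vertexGcd n j)
      ≡⟨ cong₂ incomparable (vertexGcd≡divisorOf i) (vertexGcd≡divisorOf j) ⟩
    incomparable (divisorOf (vertexClass i)) (divisorOf (vertexClass j))
      ≡⟨ divisorOf-incomparable (vertexClass i) (vertexClass j) ⟩
    pathAdj (vertexClass i) (vertexClass j) ∎
    where open ≡-Reasoning

  p*p⊥q : Coprime (p ℕ.* p) q
  p*p⊥q = Coprime.sym (coprime-* q⊥p q⊥p)
    where
    q⊥p : Coprime q p
    q⊥p = prime-coprime q p-prime p∤q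

  𝟙-p*q : ∀ a → 𝟙 (p ℕ.* q ∣? a) ≡ 𝟙 (p ∣? a) * 𝟙 (q ∣? a)
  𝟙-p*q a with p ℕ.* q ∣? a | p ∣? a | q ∣? a
  ... | yes _     | yes _   | yes _   = refl
  ... | yes pq∣a  | no  p∤a | _       = contradiction (m*n∣⇒m∣ p q pq∣a) p∤a
  ... | yes pq∣a  | yes _   | no  q∤a = contradiction (m*n∣⇒n∣ p q pq∣a) q∤a
  ... | no  pq∤a  | yes p∣a | yes q∣a = contradiction (coprime⇒*∣ p⊥q p∣a q∣a) pq∤a
  ... | no  _     | no  _   | _       = refl
  ... | no  _     | yes _   | no  _   = refl

  𝟙-n : ∀ a → 𝟙 (n ∣? a) ≡ 𝟙 (p ℕ.* p ∣? a) * 𝟙 (q ∣? a)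
  𝟙-n a with n ∣? a | p ℕ.* p ∣? a | q ∣? a
  ... | yes _    | yes _    | yes _   = refl
  ... | yes n∣a  | no  p²∤a | _       = contradiction (m*n∣⇒m∣ (p ℕ.* p) q n∣a) p²∤a
  ... | yes n∣a  | yes _    | no  q∤a = contradiction (m*n∣⇒n∣ (p ℕ.* p) q n∣a) q∤a
  ... | no  n∤a  | yes p²∣a | yes q∣a = contradiction (coprime⇒*∣ p*p⊥q p²∣a q∣a) n∤a
  ... | no  _    | no  _    | _       = refl
  ... | no  _    | yes _    | no  _   = refl

  -- Class indicators in terms of P₁ = [p ∣ a], Q₁ = [q ∣ a] and P₂ = [p² ∣ a].
  inclusionExclusion : Fin 4 → (P₁ Q₁ P₂ : ℤ) → ℤ
  inclusionExclusion 𝐩  P₁ Q₁ P₂ = (P₁ - P₁ * Q₁) - (P₂ - P₂ * Q₁)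
  inclusionExclusion 𝐪  P₁ Q₁ P₂ = Q₁ - P₁ * Q₁
  inclusionExclusion 𝐩² P₁ Q₁ P₂ = P₂ - P₂ * Q₁
  inclusionExclusion 𝐩𝐪 P₁ Q₁ P₂ = P₁ * Q₁ - P₂ * Q₁

  classIndicator : Fin 4 → ℕ → ℤ
  classIndicator k a = inclusionExclusion k (𝟙 (p ∣? a)) (𝟙 (q ∣? a)) (𝟙 (p ℕ.* p ∣? a))

  classIndicator-vertex : ∀ a → a ≢ 0 → a < n → p ∣ a ⊎ q ∣ a → ∀ k → + δ (classOf a) k ≡ classIndicator k a
  classIndicator-vertex a a≢0 a<n p∣a⊎q∣a with q ∣? a | p ∣? a | p ℕ.* p ∣? a
  ... | yes _   | yes _   | no _  = λ { 𝐩 → refl ; 𝐪 → refl ; 𝐩² → refl ; 𝐩𝐪 → refl }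
  ... | yes _   | no _    | no _  = λ { 𝐩 → refl ; 𝐪 → refl ; 𝐩² → refl ; 𝐩𝐪 → refl }
  ... | no _    | yes _   | yes _ = λ { 𝐩 → refl ; 𝐪 → refl ; 𝐩² → refl ; 𝐩𝐪 → refl }
  ... | no _    | yes _   | no _  = λ { 𝐩 → refl ; 𝐪 → refl ; 𝐩² → refl ; 𝐩𝐪 → refl }
  ... | yes q∣a | _       | yes p²∣a =
    contradiction (∣⇒≤ {{ℕ.≢-nonZero a≢0}} (coprime⇒*∣ p*p⊥q p²∣a q∣a)) (ℕ.<⇒≱ a<n)
  ... | _       | no  p∤a | yes p²∣a = contradiction (m*n∣⇒m∣ p p p²∣a) p∤a
  ... | no  q∤a | no  p∤a | _ with p∣a⊎q∣a
  ...   | inj₁ p∣a = contradiction p∣a p∤a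
  ...   | inj₂ q∣a = contradiction q∣a q∤a

  classIndicator-nonvertex : ∀ a → a ≡ 0 ⊎ (¬ p ∣ a × ¬ q ∣ a) → ∀ k → classIndicator k a ≡ + 0
  classIndicator-nonvertex a (inj₁ refl) with q ∣? 0 | p ∣? 0 | p ℕ.* p ∣? 0
  ... | yes _  | yes _  | yes _  = λ { 𝐩 → refl ; 𝐪 → refl ; 𝐩² → refl ; 𝐩𝐪 → refl }
  ... | no q∤0 | _      | _      = contradiction (q ∣0) q∤0
  ... | _      | no p∤0 | _      = contradiction (p ∣0) p∤0
  ... | _      | _      | no p²∤0 = contradiction ((p ℕ.* p) ∣0) p²∤0
  classIndicator-nonvertex a (inj₂ (p∤a , q∤a)) with q ∣? a | p ∣? a | p ℕ.* p ∣? a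
  ... | no _    | no _    | no _     = λ { 𝐩 → refl ; 𝐪 → refl ; 𝐩² → refl ; 𝐩𝐪 → refl }
  ... | yes q∣a | _       | _        = contradiction q∣a q∤a
  ... | _       | yes p∣a | _        = contradiction p∣a p∤a
  ... | _       | _       | yes p²∣a = contradiction (m*n∣⇒m∣ p p p²∣a) p∤a

  isUnit⇒∤ : ∀ (x : Fin n) {d} → IsUnit n x → d ∣ n → 1 < d → ¬ d ∣ toℕ x
  isUnit⇒∤ x unit d∣n 1<d d∣x =
    ℕ.<⇒≢ 1<d (sym (∣1⇒≡1 (∣-trans (gcd-greatest d∣x d∣n) (Equivalence.to (isUnit⇔gcd∣1 x) unit))))

  nonvertex : ∀ (x : Fin n) → ¬ IsVertex n x → toℕ x ≡ 0 ⊎ (¬ p ∣ toℕ x × ¬ q ∣ toℕ x)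
  nonvertex x not-vertex with toℕ x ℕ.≟ 0 | IsUnit? n x
  ... | yes x≡0 | _        = inj₁ x≡0
  ... | no  _   | yes unit = inj₂ (isUnit⇒∤ x unit (∣m⇒∣m*n q (m∣m*n p)) 1<p , isUnit⇒∤ x unit (n∣m*n (p ℕ.* p)) 1<q)
  ... | no  x≢0 | no  non-unit = contradiction (x≢0 , non-unit) not-vertex

  vertex-indicator : ∀ (x : Fin n) k → 𝟙 (IsVertex? n x) * (+ δ (classOf (toℕ x)) k * + 1) ≡ classIndicator k (toℕ x)
  vertex-indicator x k with IsVertex? n x
  ... | yes v = trans (ℤ.*-identityˡ _) (trans (ℤ.*-identityʳ _)
                  (classIndicator-vertex (toℕ x) (proj₁ v) (toℕ<n x) (vertex-divisor x v) k))
  ... | no  not-vertex = sym (classIndicator-nonvertex (toℕ x) (nonvertex x not-vertex) k)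

  classSize-vertexClass : ∀ k → + classSize vertexClass k ≡ sumFin n (λ x → classIndicator k (toℕ x))
  classSize-vertexClass k = begin
    + classSize vertexClass k
      ≡⟨ classSize-weight vertexClass k ⟩
    classWeight vertexClass (λ _ → + 1) k
      ≡⟨ sumFin-filter (IsVertex? n) (λ x → + δ (classOf (toℕ x)) k * + 1) (λ x → x) ⟩
    sumFin n (λ x → 𝟙 (IsVertex? n x) * (+ δ (classOf (toℕ x)) k * + 1))
      ≡⟨ sumFin-cong n (λ x → vertex-indicator x k) ⟩
    sumFin n (λ x → classIndicator k (toℕ x)) ∎
    where open ≡-Reasoning

  multiples : ∀ d t .{{_ : NonZero d}} → n ≡ t ℕ.* d → sumFin n (λ x → 𝟙 (d ∣? toℕ x)) ≡ + t
  multiples d t n≡td = subst (λ m → sumFin m (λ x → 𝟙 (d ∣? toℕ x)) ≡ + t) (sym n≡td) (count-multiples d t)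

  Σ : (ℕ → ℤ) → ℤ
  Σ f = sumFin n (λ x → f (toℕ x))

  Σ-- : ∀ f g → Σ (λ a → f a - g a) ≡ Σ f - Σ g
  Σ-- f g = sumFin-- n (f ∘ toℕ) (g ∘ toℕ)

  Σ[p∣] : Σ (λ a → 𝟙 (p ∣? a)) ≡ + (p ℕ.* q)
  Σ[p∣] = multiples p (p ℕ.* q) (trans (ℕ.*-assoc p p q) (ℕ.*-comm p (p ℕ.* q)))

  Σ[q∣] : Σ (λ a → 𝟙 (q ∣? a)) ≡ + (p ℕ.* p)
  Σ[q∣] = multiples q (p ℕ.* p) refl

  Σ[p²∣] : Σ (λ a → 𝟙 (p ℕ.* p ∣? a)) ≡ + q
  Σ[p²∣] = multiples (p ℕ.* p) q (ℕ.*-comm (p ℕ.* p) q)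

  Σ[pq∣] : Σ (λ a → 𝟙 (p ∣? a) * 𝟙 (q ∣? a)) ≡ + p
  Σ[pq∣] = trans (sumFin-cong n (λ x → sym (𝟙-p*q (toℕ x)))) (multiples (p ℕ.* q) p (ℕ.*-assoc p p q))

  Σ[p²q∣] : Σ (λ a → 𝟙 (p ℕ.* p ∣? a) * 𝟙 (q ∣? a)) ≡ + 1
  Σ[p²q∣] = trans (sumFin-cong n (λ x → sym (𝟙-n (toℕ x)))) (multiples n 1 (sym (ℕ.*-identityˡ n)))

  P Q : ℤ
  P = + p
  Q = + q

  classSizeℤ : Fin 4 → ℤ
  classSizeℤ 𝐩  = (P - + 1) * (Q - + 1)
  classSizeℤ 𝐪  = P * P - P
  classSizeℤ 𝐩² = Q - + 1
  classSizeℤ 𝐩𝐪 = P - + 1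

  classSize-vertexClassℤ : ∀ k → + classSize vertexClass k ≡ classSizeℤ k
  classSize-vertexClassℤ k = trans (classSize-vertexClass k) (count k)
    where
    [p∣] [q∣] [p²∣] [pq∣] [p²q∣] : ℕ → ℤ
    [p∣]   a = 𝟙 (p ∣? a)
    [q∣]   a = 𝟙 (q ∣? a)
    [p²∣]  a = 𝟙 (p ℕ.* p ∣? a)
    [pq∣]  a = [p∣] a * [q∣] a
    [p²q∣] a = [p²∣] a * [q∣] a
    count : ∀ k → Σ (classIndicator k) ≡ classSizeℤ k
    count 𝐩 = begin
      Σ (λ a → ([p∣] a - [pq∣] a) - ([p²∣] a - [p²q∣] a))
        ≡⟨ trans (Σ-- (λ a → [p∣] a - [pq∣] a) (λ a → [p²∣] a - [p²q∣] a))
                (cong₂ _-_ (Σ-- [p∣] [pq∣]) (Σ-- [p²∣] [p²q∣])) ⟩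
      (Σ [p∣] - Σ [pq∣]) - (Σ [p²∣] - Σ [p²q∣])
        ≡⟨ cong₂ (λ s t → (s - Σ [pq∣]) - t) (trans Σ[p∣] (ℤ.pos-* p q)) (cong₂ _-_ Σ[p²∣] Σ[p²q∣]) ⟩
      (P * Q - Σ [pq∣]) - (Q - + 1)
        ≡⟨ cong (λ s → (P * Q - s) - (Q - + 1)) Σ[pq∣] ⟩
      (P * Q - P) - (Q - + 1)
        ≡⟨ expand P Q ⟩
      (P - + 1) * (Q - + 1) ∎
      where
      open ≡-Reasoning
      expand : ∀ P Q → (P * Q - P) - (Q - + 1) ≡ (P - + 1) * (Q - + 1)
      expand = solve-∀
    count 𝐪  = trans (Σ-- [q∣] [pq∣]) (cong₂ _-_ (trans Σ[q∣] (ℤ.pos-* p p)) Σ[pq∣])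
    count 𝐩² = trans (Σ-- [p²∣] [p²q∣]) (cong₂ _-_ Σ[p²∣] Σ[p²q∣])
    count 𝐩𝐪 = trans (Σ-- [pq∣] [p²q∣]) (cong₂ _-_ Σ[pq∣] Σ[p²q∣])

  quotientDegree : Fin 4 → ℤ
  quotientDegree 𝐩  = P * P - P
  quotientDegree 𝐪  = P * Q - P
  quotientDegree 𝐩² = P * P - + 1
  quotientDegree 𝐩𝐪 = Q - + 1

  neighbourSum-classSizeℤ : ∀ k → neighbourSum classSizeℤ k ≡ quotientDegree k
  neighbourSum-classSizeℤ 𝐩  = refl
  neighbourSum-classSizeℤ 𝐪  = merge P Q
    where
    merge : ∀ P Q → (P - + 1) * (Q - + 1) + (Q - + 1) ≡ P * Q - P
    merge = solve-∀
  neighbourSum-classSizeℤ 𝐩² = merge P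
    where
    merge : ∀ P → (P * P - P) + (P - + 1) ≡ P * P - + 1
    merge = solve-∀
  neighbourSum-classSizeℤ 𝐩𝐪 = refl

  degree≡quotientDegree : ∀ i → degree n i ≡ quotientDegree (vertexClass i)
  degree≡quotientDegree i = begin
    sumFin N (adjMatrix n i)                                            ≡⟨ sumFin-cong N (adjMatrix≡pathAdj i) ⟩
    sumFin N (λ j → pathAdj (vertexClass i) (vertexClass j))            ≡⟨ sumFin-byClass vertexClass (pathAdj (vertexClass i)) ⟩
    sumFin 4 (λ l → pathAdj (vertexClass i) l * + classSize vertexClass l)
      ≡⟨ sumFin-cong 4 (λ l → cong (pathAdj (vertexClass i) l *_) (classSize-vertexClassℤ l)) ⟩
    sumFin 4 (λ l → pathAdj (vertexClass i) l * classSizeℤ l)           ≡⟨ pathDegree classSizeℤ (vertexClass i) ⟩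
    neighbourSum classSizeℤ (vertexClass i)                             ≡⟨ neighbourSum-classSizeℤ (vertexClass i) ⟩
    quotientDegree (vertexClass i)                                      ∎
    where
    open ≡-Reasoning
    N = numVertices n

  classCount : Fin 4 → ℕ
  classCount 𝐩  = (p ∸ 1) ℕ.* (q ∸ 1)
  classCount 𝐪  = p ℕ.* p ∸ p
  classCount 𝐩² = q ∸ 1
  classCount 𝐩𝐪 = p ∸ 1

  pos-∸ : ∀ a b → b ≤ a → + (a ∸ b) ≡ + a - + b
  pos-∸ a b b≤a = sym (trans (ℤ.m-n≡m⊖n a b) (ℤ.⊖-≥ b≤a))

  classCount-classSizeℤ : ∀ k → + classCount k ≡ classSizeℤ k
  classCount-classSizeℤ 𝐩  =
    trans (ℤ.pos-* (p ∸ 1) (q ∸ 1)) (cong₂ _*_ (pos-∸ p 1 (ℕ.<⇒≤ 1<p)) (pos-∸ q 1 (ℕ.<⇒≤ 1<q)))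
  classCount-classSizeℤ 𝐪  = trans (pos-∸ (p ℕ.* p) p (ℕ.m≤m*n p p)) (cong (_- P) (ℤ.pos-* p p))
  classCount-classSizeℤ 𝐩² = pos-∸ q 1 (ℕ.<⇒≤ 1<q)
  classCount-classSizeℤ 𝐩𝐪 = pos-∸ p 1 (ℕ.<⇒≤ 1<p)

  classSize-vertexClass≡classCount : ∀ k → classSize vertexClass k ≡ classCount k
  classSize-vertexClass≡classCount k = ℤ.+-injective (trans (classSize-vertexClassℤ k) (sym (classCount-classSizeℤ k)))

  classCount-positive : ∀ k → 1 ≤ classCount k
  classCount-positive 𝐩  = ℕ.*-mono-≤ (ℕ.m<n⇒0<n∸m 1<p) (ℕ.m<n⇒0<n∸m 1<q)
  classCount-positive 𝐪  = ℕ.m<n⇒0<n∸m (ℕ.m<m*n p p 1<p)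
  classCount-positive 𝐩² = ℕ.m<n⇒0<n∸m 1<q
  classCount-positive 𝐩𝐪 = ℕ.m<n⇒0<n∸m 1<p

  exponent : Fin 4 → ℕ
  exponent 𝐩  = (p ∸ 1) ℕ.* (q ∸ 1) ∸ 1
  exponent 𝐪  = p ℕ.* p ∸ p ∸ 1
  exponent 𝐩² = q ∸ 2
  exponent 𝐩𝐪 = p ∸ 2

  classSize-vertexClass∸1 : ∀ k → classSize vertexClass k ∸ 1 ≡ exponent k
  classSize-vertexClass∸1 𝐩  = cong (_∸ 1) (classSize-vertexClass≡classCount 𝐩)
  classSize-vertexClass∸1 𝐪  = cong (_∸ 1) (classSize-vertexClass≡classCount 𝐪)
  classSize-vertexClass∸1 𝐩² = trans (cong (_∸ 1) (classSize-vertexClass≡classCount 𝐩²)) (ℕ.∸-+-assoc q 1 1)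
  classSize-vertexClass∸1 𝐩𝐪 = trans (cong (_∸ 1) (classSize-vertexClass≡classCount 𝐩𝐪)) (ℕ.∸-+-assoc p 1 1)

  vertexClass-nonempty : ∀ k → 1 ≤ classSize vertexClass k
  vertexClass-nonempty k = subst (1 ≤_) (sym (classSize-vertexClass≡classCount k)) (classCount-positive k)

  classWeight-vertexClass : ∀ k → classWeight vertexClass (λ _ → + 1) k ≡ classSizeℤ k
  classWeight-vertexClass k = trans (sym (classSize-weight vertexClass k)) (classSize-vertexClassℤ k)

  module _ (x : ℤ) where

    α : Fin 4 → ℤ
    α k = x - quotientDegree k

    -- The left-hand side is the (i, j) entry of x·I − L; it is left for
    -- charPoly≡det-classMatrix to fix, as its diagonal part is local to laplacianCharPoly.
    entries : ∀ i j → _ ≡ classMatrix α pathAdj vertexClass (λ _ → + 1) i j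

    charPoly≡det-classMatrix : laplacianCharPoly n x ≡ det (numVertices n) (classMatrix α pathAdj vertexClass (λ _ → + 1))
    charPoly≡det-classMatrix = det-cong (numVertices n) entries

    entries i j with i ≟ᶠ j
    ... | yes refl = trans (cong₂ (λ d a → x - (d - a)) (degree≡quotientDegree i) (adjMatrix≡pathAdj i i))
                           (trans (diagonal x (quotientDegree c) (pathAdj c c))
                                  (cong (λ d → + d * α c + pathAdj c c * + 1) (sym (δ-refl i))))
      where
      c = vertexClass i
      diagonal : ∀ x d a → x - (d - a) ≡ + 1 * (x - d) + a * + 1
      diagonal = solve-∀
    ... | no i≢j = trans (cong (λ a → + 0 - - a) (adjMatrix≡pathAdj i j))
                         (trans (off-diagonal (α c) (pathAdj c c′))
                                (cong (λ d → + d * α c + pathAdj c c′ * + 1) (sym (δ-≢ i≢j))))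
      where
      c = vertexClass i
      c′ = vertexClass j
      off-diagonal : ∀ a b → + 0 - - b ≡ + 0 * a + b * + 1
      off-diagonal = solve-∀

    charPoly≡product : laplacianCharPoly n x ≡ prodFin 4 (λ k → α k ^ exponent k) * pathContinuant α classSizeℤ
    charPoly≡product = begin
      laplacianCharPoly n x
        ≡⟨ charPoly≡det-classMatrix ⟩
      det (numVertices n) (classMatrix α pathAdj vertexClass (λ _ → + 1))
        ≡⟨ det-classMatrix (numVertices n) α pathAdj vertexClass (λ _ → + 1) vertexClass-nonempty ⟩
      reducedDet α pathAdj vertexClass (λ _ → + 1)
        ≡⟨ cong₂ _*_ powers quotient-det ⟩
      prodFin 4 (λ k → α k ^ exponent k) * pathContinuant α classSizeℤ ∎
      where
      open ≡-Reasoning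
      powers : prodFin 4 (λ k → α k ^ (classSize vertexClass k ∸ 1)) ≡ prodFin 4 (λ k → α k ^ exponent k)
      powers = prodFin-cong 4 (λ k → cong (α k ^_) (classSize-vertexClass∸1 k))
      quotient-det : det 4 (classMatrix α pathAdj id (classWeight vertexClass (λ _ → + 1))) ≡ pathContinuant α classSizeℤ
      quotient-det = trans (det-cong 4 (classMatrix-cong {c = id} {c′ = id} (λ _ → refl) α pathAdj classWeight-vertexClass))
                       (det-pathClassMatrix α classSizeℤ)


open import Defs
open ClassMatrix using (prodFin)
open PathQuotient using (pathContinuant)
open import Data.Nat using (ℕ; _∸_) renaming (_*_ to _*ℕ_)
open import Data.Nat.Primality using (Prime)
open import Data.Integer using (ℤ; +_; _+_; _-_; _*_; _^_)
open import Data.Integer.Tactic.RingSolver using (solve-∀)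
open import Data.Fin.Base using (Fin)
open import Relation.Binary.PropositionalEquality using (_≡_; _≢_; cong; module ≡-Reasoning)

-- The ring solver does not recognise Data.Integer._^_, so the powers are
-- written in their definitional unfolding y ^ (1 + k) = y * y ^ k.
continuant≡l : ∀ x P Q →
  let sq y = y * (y * + 1)
      cube y = y * sq y
      s₀ = (P - + 1) * (Q - + 1)
      s₁ = P * P - P
      s₂ = Q - + 1
      s₃ = P - + 1
      a₀ = x - (P * P - P)
      a₁ = x - (P * Q - P)
      a₂ = x - (P * P - + 1)
      a₃ = x - (Q - + 1)
  in a₀ * (a₁ * (a₂ * a₃ - s₃ * s₂) - s₂ * s₁ * a₃) - s₁ * s₀ * (a₂ * a₃ - s₃ * s₂)
     ≡ x * cube x
       - ((P - + 1) * (+ 2 * P + + 1) + (P + + 1) * (Q - + 1)) * cube x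
       + (P * sq (P - + 1) * (P + + 1) + (P - + 1) * sq (P + + 1) * (Q - + 1)
          + P * sq (Q - + 1) + sq (P - + 1) * (Q - + 1)) * sq x
       - P * (P - + 1) * (Q - + 1) * ((P - + 1) * (P + + 1) + P * (Q - + 1)) * x
continuant≡l = solve-∀

reassociate : ∀ a b c d e → a * (b * (c * (d * + 1))) * e ≡ a * b * c * d * e
reassociate = solve-∀

mainTheorem7 : (p q : ℕ) → Prime p → Prime q → p ≢ q →
  let P = + p
      Q = + q
      l : ℤ → ℤ
      l x = (x ^ 4)
            - ((P - + 1) * (+ 2 * P + + 1) + (P + + 1) * (Q - + 1)) * (x ^ 3)
            + (P * (P - + 1) ^ 2 * (P + + 1) + (P - + 1) * (P + + 1) ^ 2 * (Q - + 1)
               + P * (Q - + 1) ^ 2 + (P - + 1) ^ 2 * (Q - + 1)) * (x ^ 2)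
            - P * (P - + 1) * (Q - + 1) * ((P - + 1) * (P + + 1) + P * (Q - + 1)) * x
  in (x : ℤ) → laplacianCharPoly (p *ℕ p *ℕ q) x
       ≡ (x - (P * P - P)) ^ ((p ∸ 1) *ℕ (q ∸ 1) ∸ 1)
         * (x - (P * Q - P)) ^ (p *ℕ p ∸ p ∸ 1)
         * (x - (P * P - + 1)) ^ (q ∸ 2)
         * (x - (Q - + 1)) ^ (p ∸ 2)
         * l x
mainTheorem7 p q p-prime q-prime p≢q x = begin
  laplacianCharPoly n x
    ≡⟨ charPoly≡product x ⟩
  prodFin 4 (λ k → α x k ^ exponent k) * pathContinuant (α x) classSizeℤ
    ≡⟨ reassociate (factor 𝐩) (factor 𝐪) (factor 𝐩²) (factor 𝐩𝐪) (pathContinuant (α x) classSizeℤ) ⟩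
  factor 𝐩 * factor 𝐪 * factor 𝐩² * factor 𝐩𝐪 * pathContinuant (α x) classSizeℤ
    ≡⟨ cong (factor 𝐩 * factor 𝐪 * factor 𝐩² * factor 𝐩𝐪 *_) (continuant≡l x P Q) ⟩
  _ ∎
  where
  open ≡-Reasoning
  open PrimeSquareTimesPrime p q p-prime q-prime p≢q
  factor : Fin 4 → ℤ
  factor k = α x k ^ exponent k
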